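{- Let $n\ge1$, let $(\pi,u)\in\operatorname{Vert}(C_n)$ and let $a,b\in u([n])$. Then $(\pi,u)$ has a rise labelled $(a,b)$ if and only if $\zeta_C(\pi,u)=(\zeta_C(\pi),d_C(\pi,u))$ has a valley labelled $(b,a)$ or $(-a,-b)$. Moreover, $\pi$ begins with a North step and $u(1)=a$ if and only if $\zeta_C(\pi,u)$ has a valley labelled $(a,-a)$.
   Context: Paths: $\mathcal L_{a,b}$ is the set of words in $\{N,E\}$ with $a$ letters $E$ and $b$ letters $N$; $\mathcal B_m$ is the set of words of length $m$ all of whose prefixes have at least as many $N$'s as $E$'s. For a path, $i$ is a rise if its $i$-th $N$ is immediately followed by an $N$; $(i,j)$ is a valley if its $i$-th $E$ is immediately followed by its $j$-th $N$; also, if a ballot path with $i$ East and $j$ North steps ends with an East step, $(i,j+1)$ counts as a valley. For an integer vector $a=(a_1,\dots,a_n)$, $j\ge0$: $\overrightarrow{S}^+_j(a)$ reads $a$ left to right writing $N$ for each entry $j$ and $E$ for each entry $j+1$; $\overleftarrow{S}^+_j(a)$ likewise reading right to left; $\overrightarrow{S}^-_j(a),\overleftarrow{S}^-_j(a)$ likewise with $N$ for entries $-j$ and $E$ for entries $-j-1$. $\mathfrak S_n^C$: bijections $u$ of $\{\pm1,\dots,\pm n\}$ with $u(-i)=-u(i)$. For $\pi\in\mathcal L_{n,n}$, $\lambda_i$ = number of East steps before the $i$-th North step, and $\mu_i=(n+1-i)-\lambda_{n+1-i}$. $\zeta_C(\pi)=\overleftarrow{S}^-_n(\mu)\overrightarrow{S}^+_n(\mu)\cdots\overleftarrow{S}^-_0(\mu)\overrightarrow{S}^+_0(\mu)$.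 $\operatorname{Vert}(C_n)$: pairs $(\pi,u)$, $\pi\in\mathcal L_{n,n}$, $u\in\mathfrak S_n^C$, with $u(i)<u(i+1)$ for every rise $i$ of $\pi$ and $u(1)>0$ if $\pi$ begins with $N$. $d_C(\pi,u)\in\mathfrak S_n^C$: for $i=0,1,\dots,n$, first write $-u(j)$ for all $j$ with $\mu_{n+1-j}=-i$ in decreasing order of $j$, then $u(j)$ for all $j$ with $\mu_{n+1-j}=i+1$ in increasing order of $j$; the resulting sequence is the window $[d_C(\pi,u)(1),\dots,d_C(\pi,u)(n)]$. Labels: a rise $i$ of $(\pi,u)$ is labelled $(u(i),u(i+1))$. For a pair $(\beta,w)$ with $\beta\in\mathcal B_{2n}$, $w\in\mathfrak S_n^C$, a valley $(i,j)$ of $\beta$ is labelled $(w(n+1-i),w(n+1-j))$ if $j\le n$ and $(w(n+1-i),w(n-j))$ if $j>n$, where $w(-k)=-w(k)$. -}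

module Defs where

open import Data.Nat as ℕ using (ℕ; zero; suc; _∸_; _≤ᵇ_)
open import Data.Integer as ℤ using (ℤ; +_; -[1+_]; -_; _-_; ∣_∣)
open import Data.Bool using (Bool; true; false; if_then_else_)
open import Data.List using (List; []; _∷_; _++_; map; concatMap; reverse; upTo; downFrom; take; length; head; last)
open import Data.List.Relation.Unary.All using (All)
open import Data.List.Relation.Unary.Unique.Propositional using (Unique)
open import Data.Maybe using (Maybe; just; nothing)
open import Data.Product using (_×_; _,_; ∃)
open import Data.Sum using (_⊎_)
open import Relation.Nullary using (does)
open import Relation.Binary.PropositionalEquality using (_≡_)

data Step : Set where
  N E : Step

Path : Set
Path = List Step

countN : Path → ℕ
countN []      = 0
countN (N ∷ s) = suc (countN s)
countN (E ∷ s) = countN s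

countE : Path → ℕ
countE []      = 0
countE (E ∷ s) = suc (countE s)
countE (N ∷ s) = countE s

at : Path → ℕ → Maybe Step
at []      _       = nothing
at (x ∷ s) zero    = just x
at (x ∷ s) (suc p) = at s p

InL : ℕ → ℕ → Path → Set
InL a b π = countE π ≡ a × countN π ≡ b

-- i is a rise of π : the i-th N (1-based) is immediately followed by an N
IsRise : Path → ℕ → Set
IsRise π i = ∃ λ p → at π p ≡ just N × at π (suc p) ≡ just N × suc (countN (take p π)) ≡ i

-- (i,j) is a valley of β : the i-th E is immediately followed by the j-th N;
-- or β ends with E, has i East and j' North steps and j = j' + 1.
IsValley : Path → ℕ × ℕ → Set
IsValley β (i , j) =
  (∃ λ p → at β p ≡ just E × at β (suc p) ≡ just N
         × suc (countE (take p β)) ≡ i × suc (countN (take (suc p) β)) ≡ j)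
  ⊎ (last β ≡ just E × countE β ≡ i × suc (countN β) ≡ j)

-- Signed permutations u ∈ 𝔖ₙᶜ, in window notation [u(1),…,u(n)]:
-- the entries are nonzero, of absolute value ≤ n, with distinct absolute values.
-- (u is then extended by u(-i) = -u(i).)
IsSignedPerm : ℕ → List ℤ → Set
IsSignedPerm n w = length w ≡ n × All (λ x → 1 ℕ.≤ ∣ x ∣ × ∣ x ∣ ℕ.≤ n) w × Unique (map ∣_∣ w)

-- u(k) for k ∈ [n] (1-based; junk value 0 outside the range)
uAt : List ℤ → ℕ → ℤ
uAt w        zero          = + 0
uAt []       (suc _)       = + 0
uAt (x ∷ w)  (suc zero)    = x
uAt (x ∷ w)  (suc (suc k)) = uAt w (suc k)

-- u(k) for k ∈ ±[n], using u(-k) = -u(k)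
wAt : List ℤ → ℤ → ℤ
wAt w (+ k)     = uAt w k
wAt w -[1+ k ]  = - uAt w (suc k)

oneTo : ℕ → List ℕ
oneTo n = map suc (upTo n)

-- λᵢ = number of East steps before the i-th North step
lam : Path → ℕ → ℕ
lam []       i             = 0
lam (E ∷ s)  i             = suc (lam s i)
lam (N ∷ s)  zero          = 0
lam (N ∷ s)  (suc zero)    = 0
lam (N ∷ s)  (suc (suc i)) = lam s (suc i)

mu : ℕ → Path → ℕ → ℤ
mu n π i = + (suc n ∸ i) - + lam π (suc n ∸ i)

muVec : ℕ → Path → List ℤ
muVec n π = map (mu n π) (oneTo n)

readS : ℤ → ℤ → List ℤ → List Step
readS vN vE = concatMap (λ x → if does (x ℤ.≟ vN) then N ∷ []
                               else if does (x ℤ.≟ vE) then E ∷ [] else [])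

S⃗⁺ S⃖⁺ S⃗⁻ S⃖⁻ : ℕ → List ℤ → List Step
S⃗⁺ j a = readS (+ j) (+ suc j) a
S⃖⁺ j a = readS (+ j) (+ suc j) (reverse a)
S⃗⁻ j a = readS (- + j) (- + suc j) a
S⃖⁻ j a = readS (- + j) (- + suc j) (reverse a)

zetaC : ℕ → Path → Path
zetaC n π = concatMap (λ j → S⃖⁻ j (muVec n π) ++ S⃗⁺ j (muVec n π)) (downFrom (suc n))

dC : ℕ → Path → List ℤ → List ℤ
dC n π u = concatMap step (upTo (suc n))
  where
  step : ℕ → List ℤ
  step i =
    concatMap (λ j → if does (mu n π (suc n ∸ j) ℤ.≟ - + i) then (- uAt u j) ∷ [] else [])
              (reverse (oneTo n))
    ++ concatMap (λ j → if does (mu n π (suc n ∸ j) ℤ.≟ + suc i) then uAt u j ∷ [] else [])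
              (oneTo n)

InVert : ℕ → Path → List ℤ → Set
InVert n π u =
  InL n n π × IsSignedPerm n u
  × (∀ i → IsRise π i → uAt u i ℤ.< uAt u (suc i))
  × (head π ≡ just N → + 0 ℤ.< uAt u 1)

riseLabel : List ℤ → ℕ → ℤ × ℤ
riseLabel u i = uAt u i , uAt u (suc i)

valleyLabel : ℕ → List ℤ → ℕ × ℕ → ℤ × ℤ
valleyLabel n w (i , j) =
  if j ≤ᵇ n then (wAt w (+ (suc n ∸ i)) , wAt w (+ (suc n ∸ j)))
            else (wAt w (+ (suc n ∸ i)) , wAt w (+ n - + j))

-- Write ν_j = μ_{n+1-j} = j - λ_j. Then ν_{j+1} ≤ ν_j + 1, with equality exactly when j is a rise
-- of π; ν_1 ≤ 1, with equality exactly when π begins with N; ν_n ≥ 0; and |ν_j| ≤ n.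
-- Tag each letter of ζ_C(π) with the entry of μ it was read from and the scan that read it. Every
-- East letter occurs once, and as ν moves by at most one between neighbouring entries, the scan that
-- produced it either continues at once with a North letter, which happens exactly at an ascent
-- ν_{k+1} = ν_k + 1 (the entries k+1, k read by S⁺ when ν_k ≥ 0, the entries k, k+1 read by S⁻
-- when ν_k < 0), or meets another East letter first; and the word ends with an East letter exactly
-- when ν_1 = 1. The tags of the East letters spell d_C(π,u) backwards without its initial block,
-- those of the North letters spell it backwards followed by that block with signs flipped. Hence a
-- valley between letters read from u(j), u(j′) is labelled (±u(j), ±u(j′)), and the labels not
-- coming from rises or from u(1) are excluded because the entries of u have distinct absolute values.

module Submission where

open import Defs
open import Data.Nat as ℕ using (ℕ; zero; suc; _+_; _∸_; _≤_; _<_; z≤n; s≤s)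
import Data.Nat.Properties as ℕP
open import Algebra.Properties.CommutativeSemigroup ℕP.+-commutativeSemigroup using (interchange)
open import Data.Nat.ListAction using (sum)
import Data.Nat.ListAction.Properties as ΣP
open import Data.Integer as ℤ using (ℤ; +_; -[1+_]; -_; ∣_∣; _⊖_)
import Data.Integer.Properties as ℤP
open import Algebra.Properties.AbelianGroup ℤP.+-0-abelianGroup using (∙-cancelˡ)
open import Data.Bool using (Bool; true; false; if_then_else_; not; T)
open import Data.Bool.Properties using (T-≡; not-involutive)
open import Data.List using (List; []; _∷_; _++_; map; concatMap; reverse; upTo; downFrom; applyUpTo; length; head; last; take)
import Data.List.Properties as LP
open import Data.List.Relation.Binary.Permutation.Propositional.Properties using (↭-reverse)
open import Data.List.Relation.Unary.All as All using (All; []; _∷_)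
import Data.List.Relation.Unary.All.Properties as AllP
open import Data.List.Relation.Unary.AllPairs.Core using ([]; _∷_)
open import Data.List.Relation.Unary.Unique.Propositional using (Unique)
open import Data.List.Membership.Propositional using (_∈_; find)
open import Data.List.Relation.Unary.Any using (here; there)
import Data.List.Membership.Propositional.Properties as ∈P
open import Data.Maybe using (just)
open import Data.Product using (_×_; _,_; ∃; ∃₂; proj₁; proj₂; map₂; uncurry)
open import Data.Product.Properties using (×-≡,≡→≡; ×-≡,≡←≡)
open import Data.Sum using (_⊎_; inj₁; inj₂)
open import Data.Empty using (⊥; ⊥-elim)
open import Function using (_∘_; case_of_)
open import Function.Bundles using (_⇔_; mk⇔; Equivalence)
open import Relation.Nullary using (does; yes; no; ¬_)
open import Relation.Nullary.Decidable using (dec-true; dec-false)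
open import Relation.Binary.PropositionalEquality

private variable
  A B : Set

length-concatMap : (f : A → List B) (xs : List A) →
  length (concatMap f xs) ≡ sum (map (length ∘ f) xs)
length-concatMap f []       = refl
length-concatMap f (x ∷ xs) =
  trans (LP.length-++ (f x)) (cong (λ k → length (f x) + k) (length-concatMap f xs))

reverse-++-∷ : (xs : List A) (x : A) (ys : List A) →
  reverse (xs ++ x ∷ ys) ≡ reverse ys ++ x ∷ reverse xs
reverse-++-∷ xs x ys = begin
  reverse (xs ++ x ∷ ys)              ≡⟨ LP.reverse-++ xs (x ∷ ys) ⟩
  reverse (x ∷ ys) ++ reverse xs      ≡⟨ cong (_++ reverse xs) (LP.unfold-reverse x ys) ⟩
  (reverse ys ++ x ∷ []) ++ reverse xs ≡⟨ LP.++-assoc (reverse ys) (x ∷ []) (reverse xs) ⟩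
  reverse ys ++ x ∷ reverse xs        ∎
  where open ≡-Reasoning

reverse-concatMap : (f : A → List B) (xs : List A) →
  reverse (concatMap f xs) ≡ concatMap (reverse ∘ f) (reverse xs)
reverse-concatMap f []       = refl
reverse-concatMap f (x ∷ xs) = begin
  reverse (f x ++ concatMap f xs)
    ≡⟨ LP.reverse-++ (f x) (concatMap f xs) ⟩
  reverse (concatMap f xs) ++ reverse (f x)
    ≡⟨ cong₂ _++_ (reverse-concatMap f xs) (sym (LP.++-identityʳ (reverse (f x)))) ⟩
  concatMap (reverse ∘ f) (reverse xs) ++ concatMap (reverse ∘ f) (x ∷ [])
    ≡⟨ LP.concatMap-++ (reverse ∘ f) (reverse xs) (x ∷ []) ⟨
  concatMap (reverse ∘ f) (reverse xs ++ x ∷ [])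
    ≡⟨ cong (concatMap (reverse ∘ f)) (LP.unfold-reverse x xs) ⟨
  concatMap (reverse ∘ f) (reverse (x ∷ xs)) ∎
  where open ≡-Reasoning

concatMap-concatMap : ∀ {C : Set} (g : B → List C) (f : A → List B) xs →
  concatMap g (concatMap f xs) ≡ concatMap (concatMap g ∘ f) xs
concatMap-concatMap g f []       = refl
concatMap-concatMap g f (x ∷ xs) =
  trans (LP.concatMap-++ g (f x) _) (cong (concatMap g (f x) ++_) (concatMap-concatMap g f xs))

concatMap-telescope : ∀ (F G : ℕ → List A) q →
  concatMap (λ i → G (suc i) ++ F i) (downFrom q) ++ G 0 ≡ G q ++ concatMap (λ i → F i ++ G i) (downFrom q)
concatMap-telescope F G zero    = sym (LP.++-identityʳ (G 0))
concatMap-telescope F G (suc q) = begin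
  ((G (suc q) ++ F q) ++ C) ++ G 0   ≡⟨ LP.++-assoc (G (suc q) ++ F q) C (G 0) ⟩
  (G (suc q) ++ F q) ++ (C ++ G 0)   ≡⟨ cong ((G (suc q) ++ F q) ++_) (concatMap-telescope F G q) ⟩
  (G (suc q) ++ F q) ++ (G q ++ C′)  ≡⟨ LP.++-assoc (G (suc q)) (F q) _ ⟩
  G (suc q) ++ (F q ++ (G q ++ C′))  ≡⟨ cong (G (suc q) ++_) (LP.++-assoc (F q) (G q) C′) ⟨
  G (suc q) ++ ((F q ++ G q) ++ C′)  ∎
  where
  open ≡-Reasoning
  C  = concatMap (λ i → G (suc i) ++ F i) (downFrom q)
  C′ = concatMap (λ i → F i ++ G i) (downFrom q)

All-concatMap⁺ : {P : B → Set} (f : A → List B) (xs : List A) →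
  (∀ {a} → a ∈ xs → All P (f a)) → All P (concatMap f xs)
All-concatMap⁺ f xs h = AllP.concat⁺ (AllP.map⁺ (All.tabulate h))

∈-concatMap : ∀ (f : A → List B) xs {y} → y ∈ concatMap f xs → ∃ λ x → x ∈ xs × y ∈ f x
∈-concatMap f xs y∈ = find (∈P.∈-concatMap⁻ f {xs} y∈)

onlyIf : Bool → A → List A
onlyIf b x = if b then x ∷ [] else []

map-onlyIf : ∀ (f : A → B) b x → map f (onlyIf b x) ≡ onlyIf b (f x)
map-onlyIf f true  x = refl
map-onlyIf f false x = refl

reverse-concatMap-onlyIf : ∀ (p : A → Bool) (f : A → B) xs →
  reverse (concatMap (λ a → onlyIf (p a) (f a)) xs) ≡ concatMap (λ a → onlyIf (p a) (f a)) (reverse xs)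
reverse-concatMap-onlyIf p f xs =
  trans (reverse-concatMap _ xs) (LP.concatMap-cong (λ a → reverse-onlyIf (p a) (f a)) (reverse xs))
  where
  reverse-onlyIf : ∀ b (x : B) → reverse (onlyIf b x) ≡ onlyIf b x
  reverse-onlyIf true  x = refl
  reverse-onlyIf false x = refl

concatMap-onlyIf-none : ∀ (p : A → Bool) (f : A → B) xs →
  (∀ {a} → a ∈ xs → p a ≡ false) → concatMap (λ a → onlyIf (p a) (f a)) xs ≡ []
concatMap-onlyIf-none p f []       _    = refl
concatMap-onlyIf-none p f (a ∷ xs) none rewrite none (here refl) =
  concatMap-onlyIf-none p f xs (none ∘ there)

++-∷-split-< : ∀ (xs : List A) x ys as bs → xs ++ x ∷ ys ≡ as ++ bs → length xs < length as →
  ∃ λ ys′ → as ≡ xs ++ x ∷ ys′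
++-∷-split-< []       x ys (a ∷ as) bs eq _ = as , cong (_∷ as) (sym (LP.∷-injectiveˡ eq))
++-∷-split-< (_ ∷ xs) x ys (a ∷ as) bs eq (s≤s lt) =
  let ys′ , as≡ = ++-∷-split-< xs x ys as bs (LP.∷-injectiveʳ eq) lt
  in ys′ , cong₂ _∷_ (sym (LP.∷-injectiveˡ eq)) as≡

++-∷-split-≥ : ∀ (xs : List A) x ys as bs → xs ++ x ∷ ys ≡ as ++ bs → length as ≤ length xs →
  ∃ λ xs′ → bs ≡ xs′ ++ x ∷ ys × length xs ≡ length as + length xs′
++-∷-split-≥ xs       x ys []       bs eq _ = xs , sym eq , refl
++-∷-split-≥ (_ ∷ xs) x ys (_ ∷ as) bs eq (s≤s le) =
  let xs′ , bs≡ , len≡ = ++-∷-split-≥ xs x ys as bs (LP.∷-injectiveʳ eq) le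
  in xs′ , bs≡ , cong suc len≡

uAt-++-∷ : ∀ xs (x : ℤ) ys → uAt (xs ++ x ∷ ys) (suc (length xs)) ≡ x
uAt-++-∷ []       x ys = refl
uAt-++-∷ (_ ∷ xs) x ys = uAt-++-∷ xs x ys

uAt-map-from-start : ∀ (val : A → ℤ) {L} xs x ys → L ≡ xs ++ x ∷ ys → uAt (map val L) (suc (length xs)) ≡ val x
uAt-map-from-start val xs x ys refl = begin
  uAt (map val (xs ++ x ∷ ys)) (suc (length xs))
    ≡⟨ cong (λ l → uAt l (suc (length xs))) (LP.map-++ val xs (x ∷ ys)) ⟩
  uAt (map val xs ++ val x ∷ map val ys) (suc (length xs))
    ≡⟨ cong (λ k → uAt (map val xs ++ val x ∷ map val ys) (suc k)) (LP.length-map val xs) ⟨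
  uAt (map val xs ++ val x ∷ map val ys) (suc (length (map val xs)))
    ≡⟨ uAt-++-∷ (map val xs) (val x) (map val ys) ⟩
  val x ∎
  where open ≡-Reasoning

uAt-map-from-end : ∀ (val : A → ℤ) L xs x ys → reverse L ≡ xs ++ x ∷ ys →
  uAt (map val L) (length L ∸ length xs) ≡ val x
uAt-map-from-end val L xs x ys rev≡ = trans (cong (uAt (map val L)) index≡)
  (uAt-map-from-start val (reverse ys) x (reverse xs) L≡)
  where
  L≡ : L ≡ reverse ys ++ x ∷ reverse xs
  L≡ = trans (sym (LP.reverse-involutive L)) (trans (cong reverse rev≡) (reverse-++-∷ xs x ys))
  index≡ : length L ∸ length xs ≡ suc (length (reverse ys))
  index≡ = begin
    length L ∸ length xs
      ≡⟨ cong (λ l → length l ∸ length xs) L≡ ⟩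
    length (reverse ys ++ x ∷ reverse xs) ∸ length xs
      ≡⟨ cong (_∸ length xs) (LP.length-++ (reverse ys)) ⟩
    length (reverse ys) + suc (length (reverse xs)) ∸ length xs
      ≡⟨ cong (λ k → length (reverse ys) + suc k ∸ length xs) (LP.length-reverse xs) ⟩
    length (reverse ys) + suc (length xs) ∸ length xs
      ≡⟨ cong (_∸ length xs) (ℕP.+-suc (length (reverse ys)) (length xs)) ⟩
    suc (length (reverse ys)) + length xs ∸ length xs
      ≡⟨ ℕP.m+n∸n≡m (suc (length (reverse ys))) (length xs) ⟩
    suc (length (reverse ys)) ∎
    where open ≡-Reasoning

suffix-unique : ∀ {x : A} xs ys xs′ ys′ → xs ++ x ∷ ys ≡ xs′ ++ x ∷ ys′ →
  All (_≢ x) xs′ → All (_≢ x) ys′ → ys ≡ ys′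
suffix-unique []       ys []        ys′ eq _         _   = LP.∷-injectiveʳ eq
suffix-unique []       ys (_ ∷ xs′) ys′ eq (x≢ ∷ _)  _   = ⊥-elim (x≢ (sym (LP.∷-injectiveˡ eq)))
suffix-unique (_ ∷ xs) ys []        ys′ eq _         ys′≢ =
  ⊥-elim (All.lookup ys′≢ (subst (_ ∈_) (LP.∷-injectiveʳ eq) (∈P.∈-++⁺ʳ xs (here refl))) refl)
suffix-unique (_ ∷ xs) ys (_ ∷ xs′) ys′ eq (_ ∷ xs′≢) ys′≢ =
  suffix-unique xs ys xs′ ys′ (LP.∷-injectiveʳ eq) xs′≢ ys′≢

record Once (x : A) (xs ys : List A) : Set where
  constructor once
  field
    prefix   : List A
    split    : xs ≡ prefix ++ x ∷ ys
    prefix∌x : All (_≢ x) prefix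
    suffix∌x : All (_≢ x) ys

once-∷[] : ∀ {x : A} → Once x (x ∷ []) []
once-∷[] = once [] refl [] []

once-++ˡ : ∀ {x : A} {xs ys} zs → All (_≢ x) zs → Once x xs ys → Once x (zs ++ xs) ys
once-++ˡ zs zs∌x (once p eq p∌x ys∌x) =
  once (zs ++ p) (trans (cong (zs ++_) eq) (sym (LP.++-assoc zs p _))) (AllP.++⁺ zs∌x p∌x) ys∌x

once-++ʳ : ∀ {x : A} {xs ys} zs → Once x xs ys → All (_≢ x) zs → Once x (xs ++ zs) (ys ++ zs)
once-++ʳ {x = x} {ys = ys} zs (once p eq p∌x ys∌x) zs∌x =
  once p (trans (cong (_++ zs) eq) (LP.++-assoc p (x ∷ ys) zs)) p∌x (AllP.++⁺ ys∌x zs∌x)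

once-concatMap : ∀ (f : A → List B) {x : B} {xs as bs : List A} {a ys} → xs ≡ as ++ a ∷ bs →
  All (_≢ x) (concatMap f as) → Once x (f a) ys → All (_≢ x) (concatMap f bs) →
  Once x (concatMap f xs) (ys ++ concatMap f bs)
once-concatMap f {as = as} {bs} {a} eq as∌x o bs∌x =
  subst (λ l → Once _ l _) (sym (trans (cong (concatMap f) eq) (LP.concatMap-++ f as (a ∷ bs))))
        (once-++ˡ (concatMap f as) as∌x (once-++ʳ (concatMap f bs) o bs∌x))

once-suffix : ∀ {x : A} {xs ys} → Once x xs ys → ∀ pre post → xs ≡ pre ++ x ∷ post → post ≡ ys
once-suffix (once p eq p∌x ys∌x) pre post eq′ = suffix-unique pre post p _ (trans (sym eq′) eq) p∌x ys∌x

ascending : ℕ → ℕ → List ℕ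
ascending a zero    = []
ascending a (suc l) = a ∷ ascending (suc a) l

descending : ℕ → List ℕ
descending zero    = []
descending (suc k) = suc k ∷ descending k

length-ascending : ∀ a l → length (ascending a l) ≡ l
length-ascending a zero    = refl
length-ascending a (suc l) = cong suc (length-ascending (suc a) l)

∈-ascending : ∀ {j} a l → j ∈ ascending a l → a ≤ j × j < a + l
∈-ascending a (suc l) (here refl) = ℕP.≤-refl , ℕP.m<m+n a (s≤s z≤n)
∈-ascending {j} a (suc l) (there j∈) with ∈-ascending (suc a) l j∈
... | a<j , j<a+1+l = ℕP.<⇒≤ a<j , subst (j <_) (sym (ℕP.+-suc a l)) j<a+1+l

∈-descending : ∀ {j} k → j ∈ descending k → 1 ≤ j × j ≤ k
∈-descending (suc k) (here refl) = s≤s z≤n , ℕP.≤-refl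
∈-descending (suc k) (there j∈)  = map₂ ℕP.m≤n⇒m≤1+n (∈-descending k j∈)

∈-downFrom : ∀ {j} k → j ∈ downFrom k → j < k
∈-downFrom (suc k) (here refl) = ℕP.≤-refl
∈-downFrom (suc k) (there j∈)  = ℕP.m≤n⇒m≤1+n (∈-downFrom k j∈)

applyUpTo≡ascending : ∀ (f : ℕ → ℕ) a l → (∀ i → f i ≡ a + i) → applyUpTo f l ≡ ascending a l
applyUpTo≡ascending f a zero    f≡ = refl
applyUpTo≡ascending f a (suc l) f≡ = cong₂ _∷_ (trans (f≡ 0) (ℕP.+-identityʳ a))
  (applyUpTo≡ascending (f ∘ suc) (suc a) l (λ i → trans (f≡ (suc i)) (ℕP.+-suc a i)))

oneTo≡ascending : ∀ n → oneTo n ≡ ascending 1 n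
oneTo≡ascending n = trans (LP.map-upTo suc n) (applyUpTo≡ascending suc 1 n (λ _ → refl))

reverse-oneTo : ∀ n → reverse (oneTo n) ≡ descending n
reverse-oneTo n = begin
  reverse (map suc (upTo n)) ≡⟨ LP.reverse-map suc (upTo n) ⟨
  map suc (reverse (upTo n)) ≡⟨ cong (map suc) (LP.reverse-upTo n) ⟩
  map suc (downFrom n)       ≡⟨ map-suc-downFrom n ⟩
  descending n               ∎
  where
  open ≡-Reasoning
  map-suc-downFrom : ∀ k → map suc (downFrom k) ≡ descending k
  map-suc-downFrom zero    = refl
  map-suc-downFrom (suc k) = cong (suc k ∷_) (map-suc-downFrom k)

reverse-ascending : ∀ n → reverse (ascending 1 n) ≡ descending n
reverse-ascending n = trans (cong reverse (sym (oneTo≡ascending n))) (reverse-oneTo n)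

reverse-descending : ∀ n → reverse (descending n) ≡ ascending 1 n
reverse-descending n =
  trans (cong reverse (sym (reverse-ascending n))) (LP.reverse-involutive (ascending 1 n))

map-∸-ascending : ∀ l a → map ((a + l) ∸_) (ascending a l) ≡ descending l
map-∸-ascending zero    a = refl
map-∸-ascending (suc l) a = cong₂ _∷_ (ℕP.m+n∸m≡n a (suc l))
  (trans (LP.map-cong (λ j → cong (_∸ j) (ℕP.+-suc a l)) (ascending (suc a) l))
         (map-∸-ascending l (suc a)))

ascending-++ : ∀ a l₁ l₂ → ascending a (l₁ + l₂) ≡ ascending a l₁ ++ ascending (a + l₁) l₂
ascending-++ a zero     l₂ = cong (λ b → ascending b l₂) (sym (ℕP.+-identityʳ a))
ascending-++ a (suc l₁) l₂ = cong (a ∷_)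
  (trans (ascending-++ (suc a) l₁ l₂) (cong (λ b → ascending (suc a) l₁ ++ ascending b l₂) (sym (ℕP.+-suc a l₁))))

ascending-split : ∀ {k n} → suc k ≤ n →
  ascending 1 n ≡ ascending 1 k ++ suc k ∷ ascending (2 + k) (n ∸ suc k)
ascending-split {k} {n} k<n = begin
  ascending 1 n                     ≡⟨ cong (ascending 1) n≡ ⟩
  ascending 1 (k + suc (n ∸ suc k)) ≡⟨ ascending-++ 1 k (suc (n ∸ suc k)) ⟩
  ascending 1 k ++ suc k ∷ ascending (2 + k) (n ∸ suc k) ∎
  where
  open ≡-Reasoning
  n≡ : n ≡ k + suc (n ∸ suc k)
  n≡ = trans (sym (ℕP.m+[n∸m]≡n k<n)) (sym (ℕP.+-suc k (n ∸ suc k)))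

ascending-∷ : ∀ {k n} → k < n → ascending (suc k) (n ∸ k) ≡ suc k ∷ ascending (2 + k) (n ∸ suc k)
ascending-∷ {k} k<n = cong (ascending (suc k)) (∸≡suc∸suc k<n)
  where
  ∸≡suc∸suc : ∀ {k n} → k < n → n ∸ k ≡ suc (n ∸ suc k)
  ∸≡suc∸suc {zero}  {suc n} _         = refl
  ∸≡suc∸suc {suc k} {suc n} (s≤s k<n) = ∸≡suc∸suc k<n

descending-split : ∀ {k n} → k < n → ∃ λ xs → descending n ≡ xs ++ suc k ∷ descending k × All (suc k <_) xs
descending-split {k} {suc n} (s≤s k≤n) with k ℕP.≟ n
... | yes refl = [] , refl , []
... | no k≢n with descending-split (ℕP.≤∧≢⇒< k≤n k≢n)
...   | xs , eq , xs> = suc n ∷ xs , cong (suc n ∷_) eq , s≤s (ℕP.≤∧≢⇒< k≤n k≢n) ∷ xs>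

downFrom-split : ∀ {m n} → m ≤ n → ∃ λ xs → downFrom (suc n) ≡ xs ++ m ∷ downFrom m × All (m <_) xs
downFrom-split {m} {n} m≤n with m ℕP.≟ n
... | yes refl = [] , refl , []
downFrom-split {m} {zero}  m≤n | no m≢n = ⊥-elim (m≢n (ℕP.n≤0⇒n≡0 m≤n))
downFrom-split {m} {suc n} m≤n | no m≢n with downFrom-split (ℕP.≤-pred (ℕP.≤∧≢⇒< m≤n m≢n))
... | xs , eq , xs> = suc n ∷ xs , cong (suc n ∷_) eq , ℕP.≤∧≢⇒< m≤n m≢n ∷ xs>

iverson : Bool → ℕ
iverson true  = 1
iverson false = 0

length-concatMap-onlyIf : ∀ (p : A → Bool) (f : A → B) xs →
  length (concatMap (λ a → onlyIf (p a) (f a)) xs) ≡ sum (map (iverson ∘ p) xs)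
length-concatMap-onlyIf p f xs =
  trans (length-concatMap _ xs) (cong sum (LP.map-cong (λ a → length-onlyIf (p a) (f a)) xs))
  where
  length-onlyIf : ∀ b (x : B) → length (onlyIf b x) ≡ iverson b
  length-onlyIf true  x = refl
  length-onlyIf false x = refl

sum-map-reverse : ∀ (f : A → ℕ) xs → sum (map f (reverse xs)) ≡ sum (map f xs)
sum-map-reverse f xs = trans (cong sum (LP.reverse-map f xs)) (ΣP.sum-↭ (↭-reverse (map f xs)))

sum-map-+ : ∀ (f g : A → ℕ) xs → sum (map (λ a → f a + g a) xs) ≡ sum (map f xs) + sum (map g xs)
sum-map-+ f g []       = refl
sum-map-+ f g (a ∷ xs) =
  trans (cong (λ s → (f a + g a) + s) (sum-map-+ f g xs)) (interchange (f a) (g a) _ _)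

sum-map-0 : ∀ (xs : List A) → sum (map (λ _ → 0) xs) ≡ 0
sum-map-0 []       = refl
sum-map-0 (_ ∷ xs) = sum-map-0 xs

sum-map-1 : ∀ (xs : List A) → sum (map (λ _ → 1) xs) ≡ length xs
sum-map-1 []       = refl
sum-map-1 (_ ∷ xs) = cong suc (sum-map-1 xs)

sum-swap : ∀ (c : A → B → ℕ) is js →
  sum (map (λ i → sum (map (c i) js)) is) ≡ sum (map (λ j → sum (map (λ i → c i j) is)) js)
sum-swap c []       js = sym (sum-map-0 js)
sum-swap c (i ∷ is) js =
  trans (cong (λ s → sum (map (c i) js) + s) (sum-swap c is js)) (sym (sum-map-+ (c i) _ js))

≟-sym : ∀ m n → does (m ℕ.≟ n) ≡ does (n ℕ.≟ m)
≟-sym m n with m ℕ.≟ n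
... | yes m≡n = trans (dec-true (m ℕ.≟ n) m≡n) (sym (dec-true (n ℕ.≟ m) (sym m≡n)))
... | no  m≢n = trans (dec-false (m ℕ.≟ n) m≢n) (sym (dec-false (n ℕ.≟ m) (m≢n ∘ sym)))

count-≟ : ∀ {c} q → c < q → sum (map (λ i → iverson (does (i ℕ.≟ c))) (upTo q)) ≡ 1
count-≟ {c} q c<q =
  trans (sym (sum-map-reverse _ (upTo q))) (trans (cong (sum ∘ map _) (LP.reverse-upTo q)) (count-downFrom q c<q))
  where
  count-none : ∀ q → q ≤ c → sum (map (λ i → iverson (does (i ℕ.≟ c))) (downFrom q)) ≡ 0
  count-none zero    _   = refl
  count-none (suc q) q<c = cong₂ _+_ (cong iverson (dec-false (q ℕ.≟ c) (ℕP.<⇒≢ q<c))) (count-none q (ℕP.<⇒≤ q<c))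
  count-downFrom : ∀ q → c < q → sum (map (λ i → iverson (does (i ℕ.≟ c))) (downFrom q)) ≡ 1
  count-downFrom (suc q) c<1+q with q ℕ.≟ c
  ... | yes refl = cong₂ _+_ (cong iverson (dec-true (c ℕ.≟ c) refl)) (count-none c ℕP.≤-refl)
  ... | no  q≢c  = cong₂ _+_ (cong iverson (dec-false (q ℕ.≟ c) q≢c))
                             (count-downFrom q (ℕP.≤∧≢⇒< (ℕP.≤-pred c<1+q) (q≢c ∘ sym)))

-- Every integer x is -i or i + 1 for exactly one i : ℕ, namely class x.
class : ℤ → ℕ
class (+ zero)  = 0
class (+ suc k) = k
class -[1+ k ]  = suc k

class-hits : ∀ x i → iverson (does (x ℤ.≟ - + i)) + iverson (does (x ℤ.≟ + suc i)) ≡ iverson (does (i ℕ.≟ class x))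
class-hits (+ zero)  zero    = refl
class-hits (+ zero)  (suc i) = refl
class-hits (+ suc k) zero    = cong iverson (≟-sym k 0)
class-hits (+ suc k) (suc i) = cong iverson (≟-sym k (suc i))
class-hits -[1+ k ]  zero    = refl
class-hits -[1+ k ]  (suc i) = trans (ℕP.+-identityʳ _) (cong iverson (≟-sym k i))

class≤ : ∀ {n x} → - + n ℤ.≤ x → x ℤ.≤ + n → class x ≤ n
class≤ {x = + zero}  _ _          = z≤n
class≤ {x = + suc k} _ (ℤ.+≤+ le) = ℕP.<⇒≤ le
class≤ {n} {x = -[1+ k ]} le _  = ℤP.drop‿+≤+ (ℤP.neg-cancel-≤ {+ n} {+ suc k} le)

hits : ℤ → ℕ → ℕ
hits x i = iverson (does (x ℤ.≟ - + i)) + iverson (does (x ℤ.≟ + suc i))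

sum-hits : ∀ {n x} → - + n ℤ.≤ x → x ℤ.≤ + n → sum (map (hits x) (upTo (suc n))) ≡ 1
sum-hits {n} {x} lo hi = trans (cong sum (LP.map-cong (class-hits x) (upTo (suc n)))) (count-≟ (suc n) (s≤s (class≤ lo hi)))

≤⇒≡⊎< : ∀ {x y : ℤ} → x ℤ.≤ y → x ≡ y ⊎ x ℤ.< y
≤⇒≡⊎< {x} {y} x≤y with x ℤ.≟ y
... | yes x≡y = inj₁ x≡y
... | no  x≢y = inj₂ (ℤP.≤∧≢⇒< x≤y x≢y)

nonneg-form : ∀ {x} → + 0 ℤ.≤ x → ∃ λ m → x ≡ + m
nonneg-form {+ m} _ = m , refl

neg-form : ∀ {x} → x ℤ.< + 0 → ∃ λ m → x ≡ -[1+ m ]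
neg-form { -[1+ m ]} _            = m , refl
neg-form {+ _}      (ℤ.+<+ ())

suc-cancel-≤ : ∀ {x y : ℤ} → ℤ.suc x ℤ.≤ ℤ.suc y → x ℤ.≤ y
suc-cancel-≤ {x} {y} = subst₂ ℤ._≤_ (ℤP.pred-suc x) (ℤP.pred-suc y) ∘ ℤP.pred-mono

0⊖≡- : ∀ m → 0 ⊖ m ≡ - + m
0⊖≡- zero    = refl
0⊖≡- (suc m) = refl

⊖-cancelˡ : ∀ m {a b} → m ⊖ a ≡ m ⊖ b → a ≡ b
⊖-cancelˡ m {a} {b} eq = ℤP.+-injective (ℤP.neg-injective
  (∙-cancelˡ (+ m) (- + a) (- + b) (trans (ℤP.[+m]-[+n]≡m⊖n m a) (trans eq (sym (ℤP.[+m]-[+n]≡m⊖n m b))))))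

lam-mono : ∀ π {i} → 1 ≤ i → lam π i ≤ lam π (suc i)
lam-mono []      _ = z≤n
lam-mono (E ∷ π) i≥1 = s≤s (lam-mono π i≥1)
lam-mono (N ∷ π) {suc zero}    _ = z≤n
lam-mono (N ∷ π) {suc (suc i)} _ = lam-mono π (s≤s z≤n)

lam≤countE : ∀ π i → lam π i ≤ countE π
lam≤countE []      i = z≤n
lam≤countE (E ∷ π) i = s≤s (lam≤countE π i)
lam≤countE (N ∷ π) zero          = z≤n
lam≤countE (N ∷ π) (suc zero)    = z≤n
lam≤countE (N ∷ π) (suc (suc i)) = lam≤countE π (suc i)

IsRise⇒lam-flat : ∀ π i → IsRise π i → 1 ≤ i × suc i ≤ countN π × lam π (suc i) ≡ lam π i
IsRise⇒lam-flat []      i (zero , () , _)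
IsRise⇒lam-flat []      i (suc p , () , _)
IsRise⇒lam-flat (E ∷ π) i (zero , () , _)
IsRise⇒lam-flat (E ∷ π) i (suc p , rise) = map₂ (map₂ (cong suc)) (IsRise⇒lam-flat π i (p , rise))
IsRise⇒lam-flat (N ∷ N ∷ π) .1 (zero , refl , refl , refl) = s≤s z≤n , s≤s (s≤s z≤n) , refl
IsRise⇒lam-flat (N ∷ [])    _  (zero , refl , () , _)
IsRise⇒lam-flat (N ∷ E ∷ π) _  (zero , refl , () , _)
IsRise⇒lam-flat (N ∷ π) .(suc (suc (countN (take p π)))) (suc p , N₁ , N₂ , refl)
  with IsRise⇒lam-flat π _ (p , N₁ , N₂ , refl)
... | _ , i<countN , flat = s≤s z≤n , s≤s i<countN , flat

lam-flat⇒IsRise : ∀ π i → 1 ≤ i → suc i ≤ countN π → lam π (suc i) ≡ lam π i → IsRise π i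
lam-flat⇒IsRise []      i _ () _
lam-flat⇒IsRise (E ∷ π) i i≥1 i<countN flat with lam-flat⇒IsRise π i i≥1 i<countN (ℕP.suc-injective flat)
... | p , rise = suc p , rise
lam-flat⇒IsRise (N ∷ N ∷ π) (suc zero) _ _ _ = zero , refl , refl , refl
lam-flat⇒IsRise (N ∷ E ∷ π) (suc zero) _ _ ()
lam-flat⇒IsRise (N ∷ [])    (suc zero) _ (s≤s ()) _
lam-flat⇒IsRise (N ∷ π) (suc (suc i)) _ (s≤s i<countN) flat with lam-flat⇒IsRise π (suc i) (s≤s z≤n) i<countN flat
... | p , N₁ , N₂ , c = suc p , N₁ , N₂ , cong suc c

head≡N⇒lam₁≡0 : ∀ π → head π ≡ just N → lam π 1 ≡ 0
head≡N⇒lam₁≡0 (N ∷ π) _ = refl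

lam₁≡0⇒head≡N : ∀ π → 1 ≤ countN π → lam π 1 ≡ 0 → head π ≡ just N
lam₁≡0⇒head≡N (N ∷ π) _ _ = refl
lam₁≡0⇒head≡N (E ∷ π) _ ()

uAt-All : ∀ {P : ℤ → Set} {w} → All P w → ∀ {k} → 1 ≤ k → k ≤ length w → P (uAt w k)
uAt-All (p ∷ _)  {suc zero}    _ _       = p
uAt-All (_ ∷ ps) {suc (suc k)} _ (s≤s k≤) = uAt-All ps (s≤s z≤n) k≤

uAt-∣∣-injective : ∀ {w} → Unique (map ∣_∣ w) →
  ∀ {j k} → 1 ≤ j → j ≤ length w → 1 ≤ k → k ≤ length w →
  ∣ uAt w j ∣ ≡ ∣ uAt w k ∣ → j ≡ k
uAt-∣∣-injective {_ ∷ w} _ {suc zero} {suc zero} _ _ _ _ _ = refl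
uAt-∣∣-injective {_ ∷ w} (fresh ∷ _) {suc zero} {suc (suc k)} _ _ _ (s≤s k≤) eq =
  ⊥-elim (uAt-All (AllP.map⁻ fresh) (s≤s z≤n) k≤ eq)
uAt-∣∣-injective {_ ∷ w} (fresh ∷ _) {suc (suc j)} {suc zero} _ (s≤s j≤) _ _ eq =
  ⊥-elim (uAt-All (AllP.map⁻ fresh) (s≤s z≤n) j≤ (sym eq))
uAt-∣∣-injective {_ ∷ w} (_ ∷ unique) {suc (suc j)} {suc (suc k)} _ (s≤s j≤) _ (s≤s k≤) eq =
  cong suc (uAt-∣∣-injective unique (s≤s z≤n) j≤ (s≤s z≤n) k≤ eq)

∈⇒uAt : ∀ {a : ℤ} {w} → a ∈ w → ∃ λ j → 1 ≤ j × j ≤ length w × uAt w j ≡ a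
∈⇒uAt (here refl) = 1 , s≤s z≤n , s≤s z≤n , refl
∈⇒uAt {w = _ ∷ w} (there a∈) with ∈⇒uAt a∈
... | suc j , _ , j≤ , eq = suc (suc j) , s≤s z≤n , s≤s j≤ , eq

module SignedPerm {n : ℕ} {u : List ℤ} (σ : IsSignedPerm n u) where

  index : ∀ {a} → a ∈ u → ∃ λ j → 1 ≤ j × j ≤ n × uAt u j ≡ a
  index a∈ with ∈⇒uAt a∈
  ... | j , j≥1 , j≤ , eq = j , j≥1 , subst (j ≤_) (proj₁ σ) j≤ , eq

  private
    ≤length : ∀ {j} → j ≤ n → j ≤ length u
    ≤length {j} = subst (j ≤_) (sym (proj₁ σ))

  no-opposite : ∀ {j k} → 1 ≤ j → j ≤ n → 1 ≤ k → k ≤ n → uAt u j ≢ - uAt u k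
  no-opposite {j} {k} j≥1 j≤n k≥1 k≤n eq
    with uAt-∣∣-injective (proj₂ (proj₂ σ)) j≥1 (≤length j≤n) k≥1 (≤length k≤n)
           (trans (cong ∣_∣ eq) (ℤP.∣-i∣≡∣i∣ (uAt u k)))
  ... | refl = self-opposite (uAt u j) eq (proj₁ (uAt-All (proj₁ (proj₂ σ)) j≥1 (≤length j≤n)))
    where
    self-opposite : ∀ x → x ≡ - x → 1 ≤ ∣ x ∣ → ⊥
    self-opposite (+ zero)  _  ()
    self-opposite (+ suc x) () _
    self-opposite -[1+ x ]  () _

-- Tagged words

-- The tag (true , j) marks a letter read from μ_{n+1-j} by a scan S⁺, and (false , j) one read by S⁻.
Tag : Set
Tag = Bool × ℕ

Letter : Set
Letter = Step × Tag

shape : List Letter → Path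
shape = map proj₁

flip : Tag → Tag
flip (b , j) = (not b , j)

letter : ℤ → ℤ → Tag → ℤ → List Letter
letter vN vE t x = if does (x ℤ.≟ vN) then (N , t) ∷ [] else onlyIf (does (x ℤ.≟ vE)) (E , t)

module _ {vN vE : ℤ} {t : Tag} {x : ℤ} where

  letter-N : x ≡ vN → letter vN vE t x ≡ (N , t) ∷ []
  letter-N x≡vN = cong (if_then _ else _) (dec-true (x ℤ.≟ vN) x≡vN)

  letter-E : vN ≢ vE → x ≡ vE → letter vN vE t x ≡ (E , t) ∷ []
  letter-E vN≢vE x≡vE = cong₂ (λ b c → if b then _ else onlyIf c _)
    (dec-false (x ℤ.≟ vN) (λ x≡vN → vN≢vE (trans (sym x≡vN) x≡vE))) (dec-true (x ℤ.≟ vE) x≡vE)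

  letter-none : x ≢ vN → x ≢ vE → letter vN vE t x ≡ []
  letter-none x≢vN x≢vE = cong₂ (λ b c → if b then _ else onlyIf c _)
    (dec-false (x ℤ.≟ vN) x≢vN) (dec-false (x ℤ.≟ vE) x≢vE)

  ∈-letter : ∀ {t′} → (E , t′) ∈ letter vN vE t x → t′ ≡ t × x ≡ vE
  ∈-letter E∈ with x ℤ.≟ vN | x ℤ.≟ vE
  ∈-letter (here ())  | yes _ | _
  ∈-letter (there ()) | yes _ | _
  ∈-letter (here refl) | no _ | yes x≡vE = refl , x≡vE

  ∌-letter : ∀ {t′} → (t′ ≡ t → x ≢ vE) → All (_≢ (E , t′)) (letter vN vE t x)
  ∌-letter h = All.tabulate λ y∈ y≡ → let t′≡t , x≡vE = ∈-letter (subst (_∈ _) y≡ y∈) in h t′≡t x≡vE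

  shape-letter : shape (letter vN vE t x) ≡ (if does (x ℤ.≟ vN) then N ∷ [] else if does (x ℤ.≟ vE) then E ∷ [] else [])
  shape-letter with does (x ℤ.≟ vN) | does (x ℤ.≟ vE)
  ... | true  | _     = refl
  ... | false | true  = refl
  ... | false | false = refl

readS≡shape : ∀ vN vE b (ν : ℕ → ℤ) js →
  readS vN vE (map ν js) ≡ shape (concatMap (λ j → letter vN vE (b , j) (ν j)) js)
readS≡shape vN vE b ν js = begin
  readS vN vE (map ν js)
    ≡⟨ LP.concatMap-map _ ν js ⟩
  concatMap (λ j → if does (ν j ℤ.≟ vN) then N ∷ [] else if does (ν j ℤ.≟ vE) then E ∷ [] else []) js
    ≡⟨ LP.concatMap-cong (λ j → sym (shape-letter {vN} {vE} {b , j} {ν j})) js ⟩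
  concatMap (λ j → shape (letter vN vE (b , j) (ν j))) js
    ≡⟨ LP.map-concatMap proj₁ _ js ⟨
  shape (concatMap (λ j → letter vN vE (b , j) (ν j)) js) ∎
  where open ≡-Reasoning

eTag nTag : Letter → List Tag
eTag (E , t) = t ∷ []
eTag (N , t) = []
nTag (N , t) = t ∷ []
nTag (E , t) = []

Es Ns : List Letter → List Tag
Es = concatMap eTag
Ns = concatMap nTag

length-Es : ∀ L → length (Es L) ≡ countE (shape L)
length-Es []            = refl
length-Es ((E , _) ∷ L) = cong suc (length-Es L)
length-Es ((N , _) ∷ L) = length-Es L

length-Ns : ∀ L → length (Ns L) ≡ countN (shape L)
length-Ns []            = refl
length-Ns ((N , _) ∷ L) = cong suc (length-Ns L)
length-Ns ((E , _) ∷ L) = length-Ns L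

Es-++-E : ∀ pre t rest → Es (pre ++ (E , t) ∷ rest) ≡ Es pre ++ t ∷ Es rest
Es-++-E pre t rest = LP.concatMap-++ eTag pre ((E , t) ∷ rest)

Ns-++-E-N : ∀ pre t t′ rest → Ns (pre ++ (E , t) ∷ (N , t′) ∷ rest) ≡ Ns pre ++ t′ ∷ Ns rest
Ns-++-E-N pre t t′ rest = LP.concatMap-++ nTag pre ((E , t) ∷ (N , t′) ∷ rest)

module _ {vN vE : ℤ} {t : Tag} {x : ℤ} where

  Es-letter : vN ≢ vE → Es (letter vN vE t x) ≡ onlyIf (does (x ℤ.≟ vE)) t
  Es-letter vN≢vE with x ℤ.≟ vN | x ℤ.≟ vE
  ... | yes x≡vN | yes x≡vE = ⊥-elim (vN≢vE (trans (sym x≡vN) x≡vE))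
  ... | yes _    | no _     = refl
  ... | no _     | yes _    = refl
  ... | no _     | no _     = refl

  Ns-letter : Ns (letter vN vE t x) ≡ onlyIf (does (x ℤ.≟ vN)) t
  Ns-letter with does (x ℤ.≟ vN) | does (x ℤ.≟ vE)
  ... | true  | _     = refl
  ... | false | true  = refl
  ... | false | false = refl

private
  countE-take : ∀ pre (L : List Letter) → countE (take (length pre) (shape (pre ++ L))) ≡ length (Es pre)
  countE-take []              L = refl
  countE-take ((E , _) ∷ pre) L = cong suc (countE-take pre L)
  countE-take ((N , _) ∷ pre) L = countE-take pre L

  countN-take : ∀ pre t (L : List Letter) →
    countN (take (suc (length pre)) (shape (pre ++ (E , t) ∷ L))) ≡ length (Ns pre)
  countN-take []              t L = refl
  countN-take ((E , _) ∷ pre) t L = countN-take pre t L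
  countN-take ((N , _) ∷ pre) t L = cong suc (countN-take pre t L)

  at-E-N : ∀ pre t t′ (post : List Letter) →
    at (shape (pre ++ (E , t) ∷ (N , t′) ∷ post)) (length pre) ≡ just E ×
    at (shape (pre ++ (E , t) ∷ (N , t′) ∷ post)) (suc (length pre)) ≡ just N
  at-E-N []        t t′ post = refl , refl
  at-E-N (_ ∷ pre) t t′ post = at-E-N pre t t′ post

  E-N-at : ∀ (L : List Letter) p → at (shape L) p ≡ just E → at (shape L) (suc p) ≡ just N →
    ∃₂ λ pre t → ∃₂ λ t′ post → L ≡ pre ++ (E , t) ∷ (N , t′) ∷ post × p ≡ length pre
  E-N-at ((E , t) ∷ (N , t′) ∷ L) zero    refl refl = [] , t , t′ , L , refl , refl
  E-N-at (x ∷ L)                  (suc p) atE  atN  =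
    let pre , t , t′ , post , split , p≡ = E-N-at L p atE atN
    in x ∷ pre , t , t′ , post , cong (x ∷_) split , cong suc p≡

  last-E : ∀ pre t → last (shape (pre ++ (E , t) ∷ [])) ≡ just E
  last-E []            t = refl
  last-E (_ ∷ [])      t = refl
  last-E (_ ∷ y ∷ pre) t = last-E (y ∷ pre) t

  E-last : ∀ (L : List Letter) → last (shape L) ≡ just E → ∃₂ λ pre t → L ≡ pre ++ (E , t) ∷ []
  E-last ((E , t) ∷ [])  refl   = [] , t , refl
  E-last (x ∷ y ∷ L)     lastE =
    let pre , t , split = E-last (y ∷ L) lastE in x ∷ pre , t , cong (x ∷_) split

IsValley⇒split : ∀ (L : List Letter) {v} → IsValley (shape L) v →
    (∃₂ λ pre t → ∃₂ λ t′ post → L ≡ pre ++ (E , t) ∷ (N , t′) ∷ post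
                                × v ≡ (suc (length (Es pre)) , suc (length (Ns pre))))
  ⊎ (∃₂ λ pre t → L ≡ pre ++ (E , t) ∷ [] × v ≡ (length (Es L) , suc (length (Ns L))))
IsValley⇒split L (inj₁ (p , atE , atN , refl , refl)) with E-N-at L p atE atN
... | pre , t , t′ , post , refl , refl =
  inj₁ (pre , t , t′ , post , refl , cong₂ (λ i j → suc i , suc j) (countE-take pre _) (countN-take pre t _))
IsValley⇒split L (inj₂ (lastE , refl , refl)) =
  let pre , t , split = E-last L lastE
  in inj₂ (pre , t , split , cong₂ (λ i j → i , suc j) (sym (length-Es L)) (sym (length-Ns L)))

split⇒IsValley : ∀ (L : List Letter) pre {t t′} post → L ≡ pre ++ (E , t) ∷ (N , t′) ∷ post →
  IsValley (shape L) (suc (length (Es pre)) , suc (length (Ns pre)))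
split⇒IsValley L pre {t} {t′} post refl = inj₁
  (length pre , proj₁ (at-E-N pre t t′ post) , proj₂ (at-E-N pre t t′ post)
  , cong suc (countE-take pre _) , cong suc (countN-take pre t _))

end⇒IsValley : ∀ (L : List Letter) pre {t} → L ≡ pre ++ (E , t) ∷ [] →
  IsValley (shape L) (length (Es L) , suc (length (Ns L)))
end⇒IsValley L pre {t} refl = inj₂ (last-E pre t , sym (length-Es L) , cong suc (sym (length-Ns L)))

proj₁-valleyLabel : ∀ n w i j → proj₁ (valleyLabel n w (i , j)) ≡ wAt w (+ (suc n ∸ i))
proj₁-valleyLabel n w i j with j ℕ.≤ᵇ n
... | true  = refl
... | false = refl

≤ᵇ≡true : ∀ {m n} → m ≤ n → (m ℕ.≤ᵇ n) ≡ true
≤ᵇ≡true = Equivalence.to T-≡ ∘ ℕP.≤⇒≤ᵇ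

≤ᵇ≡false : ∀ {m n} → n < m → (m ℕ.≤ᵇ n) ≡ false
≤ᵇ≡false {m} {n} n<m = ¬T⇒≡false (ℕP.<⇒≱ n<m ∘ ℕP.≤ᵇ⇒≤ m n)
  where
  ¬T⇒≡false : ∀ {b} → ¬ T b → b ≡ false
  ¬T⇒≡false {false} _  = refl
  ¬T⇒≡false {true}  ¬t = ⊥-elim (¬t _)

proj₂-valleyLabel-< : ∀ n w i {f} → f < n → proj₂ (valleyLabel n w (i , suc f)) ≡ uAt w (n ∸ f)
proj₂-valleyLabel-< n w i f<n rewrite ≤ᵇ≡true f<n = refl

proj₂-valleyLabel-≥ : ∀ n w i {f} → n ≤ f → proj₂ (valleyLabel n w (i , suc f)) ≡ - uAt w (suc (f ∸ n))
proj₂-valleyLabel-≥ n w i {f} n≤f rewrite ≤ᵇ≡false {suc f} {n} (s≤s n≤f) = cong (wAt w) n-[1+f]≡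
  where
  n-[1+f]≡ : + n ℤ.- + suc f ≡ -[1+ f ∸ n ]
  n-[1+f]≡ = trans (ℤP.⊖-< (s≤s n≤f)) (cong (λ k → - + k) (ℕP.+-∸-assoc 1 n≤f))

-- The tagged word of a height sequence

-- ν j stands for μ_{n+1-j} = j - λ_j.
record Heights (n : ℕ) (ν : ℕ → ℤ) : Set where
  field
    n≥1     : 1 ≤ n
    step≤1  : ∀ {j} → 1 ≤ j → suc j ≤ n → ν (suc j) ℤ.≤ ℤ.suc (ν j)
    first≤1 : ν 1 ℤ.≤ + 1
    last≥0  : + 0 ℤ.≤ ν n
    bounded : ∀ {j} → 1 ≤ j → j ≤ n → - + n ℤ.≤ ν j × ν j ℤ.≤ + n

module Word {n : ℕ} {ν : ℕ → ℤ} (H : Heights n ν) where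
  open Heights H

  negLetter posLetter : ℕ → ℕ → List Letter
  negLetter m j = letter (- + m) -[1+ m ] (false , j) (ν j)
  posLetter m j = letter (+ m) (+ suc m) (true , j) (ν j)

  negScan posScan : ℕ → List ℕ → List Letter
  negScan m = concatMap (negLetter m)
  posScan m = concatMap (posLetter m)

  -- S⃖⁻_m(μ) S⃗⁺_m(μ); since μ_i = ν_{n+1-i}, reading μ backwards runs through j = 1, …, n
  level : ℕ → List Letter
  level m = negScan m (ascending 1 n) ++ posScan m (descending n)

  levelsBelow : ℕ → List Letter
  levelsBelow m = concatMap level (downFrom m)

  word : List Letter
  word = levelsBelow (suc n)

  private
    +m≢+[1+m] : ∀ m → + m ≢ + suc m
    +m≢+[1+m] m eq = ℕP.1+n≢n (sym (ℤP.+-injective eq))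

    -m≢-[1+m] : ∀ m → - + m ≢ -[1+ m ]
    -m≢-[1+m] zero    ()
    -m≢-[1+m] (suc m) eq = ℕP.1+n≢n (sym (ℤP.-[1+-injective eq))

  ∌E-negLetter : ∀ {m j t′} → (t′ ≡ (false , j) → ν j ≢ -[1+ m ]) → All (_≢ (E , t′)) (negLetter m j)
  ∌E-negLetter = ∌-letter

  ∌E-posLetter : ∀ {m j t′} → (t′ ≡ (true , j) → ν j ≢ + suc m) → All (_≢ (E , t′)) (posLetter m j)
  ∌E-posLetter = ∌-letter

  ∈E-negLetter : ∀ {m j t′} → (E , t′) ∈ negLetter m j → t′ ≡ (false , j) × ν j ≡ -[1+ m ]
  ∈E-negLetter = ∈-letter

  ∈E-posLetter : ∀ {m j t′} → (E , t′) ∈ posLetter m j → t′ ≡ (true , j) × ν j ≡ + suc m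
  ∈E-posLetter = ∈-letter

  ∌E-level : ∀ {b k m} → ν k ≢ + suc m → ν k ≢ -[1+ m ] → All (_≢ (E , b , k)) (level m)
  ∌E-level {m = m} ν≢⁺ ν≢⁻ =
    AllP.++⁺ (All-concatMap⁺ (negLetter m) (ascending 1 n) λ _ → ∌E-negLetter λ { refl → ν≢⁻ })
             (All-concatMap⁺ (posLetter m) (descending n) λ _ → ∌E-posLetter λ { refl → ν≢⁺ })

  once-posE : ∀ {k m} → 1 ≤ k → k ≤ n → ν k ≡ + suc m →
    Once (E , true , k) word (posScan m (descending (k ∸ 1)) ++ levelsBelow m)
  once-posE {suc k} {m} k≥1 k<n ν≡ with downFrom-split (ℕP.<⇒≤ m<n) | descending-split k<n
    where m<n = ℤP.drop‿+≤+ (subst (ℤ._≤ + n) ν≡ (proj₂ (bounded k≥1 k<n)))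
  ... | ms , split-ms , ms>m | js , split-js , js>k =
    once-concatMap level split-ms (other-levels λ m′∈ → ℕP.<⇒≢ (All.lookup ms>m m′∈))
      (once-++ˡ (negScan m (ascending 1 n)) (All-concatMap⁺ (negLetter m) (ascending 1 n) λ _ → ∌E-negLetter λ ())
        (once-concatMap (posLetter m) split-js
          (All-concatMap⁺ (posLetter m) js λ j∈ → ∌E-posLetter λ t≡ _ →
             ℕP.<⇒≢ (All.lookup js>k j∈) (cong proj₂ t≡))
          (subst (λ l → Once _ l []) (sym (letter-E (+m≢+[1+m] m) ν≡)) once-∷[])
          (All-concatMap⁺ (posLetter m) (descending k) λ j∈ → ∌E-posLetter λ t≡ _ →
             ℕP.<-irrefl (sym (cong proj₂ t≡)) (s≤s (proj₂ (∈-descending k j∈))))))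
      (other-levels λ m′∈ → ℕP.<⇒≢ (∈-downFrom m m′∈) ∘ sym)
    where
    other-levels : ∀ {ms′} → (∀ {m′} → m′ ∈ ms′ → m ≢ m′) →
      All (_≢ (E , true , suc k)) (concatMap level ms′)
    other-levels {ms′} m≢ = All-concatMap⁺ level ms′ λ m′∈ →
      ∌E-level (λ ν≡′ → m≢ m′∈ (ℕP.suc-injective (ℤP.+-injective (trans (sym ν≡) ν≡′))))
               (λ ν≡′ → case trans (sym ν≡) ν≡′ of λ ())

  once-negE : ∀ {k m} → 1 ≤ k → k ≤ n → ν k ≡ -[1+ m ] →
    Once (E , false , k) word ((negScan m (ascending (suc k) (n ∸ k)) ++ posScan m (descending n)) ++ levelsBelow m)
  once-negE {suc k} {m} k≥1 k<n ν≡ with downFrom-split (ℕP.<⇒≤ m<n)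
    where m<n = ℤP.drop‿+≤+ (ℤP.neg-cancel-≤ {+ n} {+ suc m} (subst (- + n ℤ.≤_) ν≡ (proj₁ (bounded k≥1 k<n))))
  ... | ms , split-ms , ms>m =
    once-concatMap level split-ms (other-levels λ m′∈ → ℕP.<⇒≢ (All.lookup ms>m m′∈))
      (once-++ʳ (posScan m (descending n))
        (once-concatMap (negLetter m) (ascending-split k<n)
          (All-concatMap⁺ (negLetter m) (ascending 1 k) λ j∈ → ∌E-negLetter λ t≡ _ →
             ℕP.<-irrefl (sym (cong proj₂ t≡)) (proj₂ (∈-ascending 1 k j∈)))
          (subst (λ l → Once _ l []) (sym (letter-E (-m≢-[1+m] m) ν≡)) once-∷[])
          (All-concatMap⁺ (negLetter m) (ascending (2 + k) (n ∸ suc k)) λ j∈ → ∌E-negLetter λ t≡ _ →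
             ℕP.<⇒≢ (proj₁ (∈-ascending (2 + k) (n ∸ suc k) j∈)) (cong proj₂ t≡)))
        (All-concatMap⁺ (posLetter m) (descending n) λ _ → ∌E-posLetter λ ()))
      (other-levels λ m′∈ → ℕP.<⇒≢ (∈-downFrom m m′∈) ∘ sym)
    where
    other-levels : ∀ {ms′} → (∀ {m′} → m′ ∈ ms′ → m ≢ m′) →
      All (_≢ (E , false , suc k)) (concatMap level ms′)
    other-levels {ms′} m≢ = All-concatMap⁺ level ms′ λ m′∈ →
      ∌E-level (λ ν≡′ → case trans (sym ν≡) ν≡′ of λ ())
               (λ ν≡′ → m≢ m′∈ (ℤP.-[1+-injective (trans (sym ν≡) ν≡′)))

  -- Going down from j, ν drops by at most one per step and ends at ν_1 ≤ m + 1, so it meets m + 1 before m.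
  posScan-starts-with-E : ∀ {m j} → 1 ≤ j → j ≤ n → + suc m ℤ.≤ ν j →
    ∃₂ λ t rest → posScan m (descending j) ≡ (E , t) ∷ rest
  posScan-starts-with-E {m} {suc j} j≥1 j≤n m+1≤ν with ≤⇒≡⊎< m+1≤ν
  ... | inj₁ m+1≡ν = _ , _ , cong (_++ posScan m (descending j)) (letter-E (+m≢+[1+m] m) (sym m+1≡ν))
  ... | inj₂ m+1<ν =
    let t , rest , eq = rest-starts-with-E j j≤n m+1<ν
    in t , rest , trans (cong (_++ posScan m (descending j)) (letter-none ν≢m (ℤP.<⇒≢ m+1<ν ∘ sym))) eq
    where
    ν≢m : ν (suc j) ≢ + m
    ν≢m ν≡m = ℤP.<-asym m+1<ν (subst (ℤ._< + suc m) (sym ν≡m) (ℤ.+<+ ℕP.≤-refl))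
    rest-starts-with-E : ∀ j → suc j ≤ n → + suc m ℤ.< ν (suc j) →
      ∃₂ λ t rest → posScan m (descending j) ≡ (E , t) ∷ rest
    rest-starts-with-E zero    _   m+1<ν = case ℤP.<-≤-trans m+1<ν first≤1 of λ { (ℤ.+<+ (s≤s ())) }
    rest-starts-with-E (suc j) j<n m+1<ν = posScan-starts-with-E (s≤s z≤n) (ℕP.<⇒≤ j<n)
      (suc-cancel-≤ (ℤP.≤-trans (ℤP.i<j⇒suc[i]≤j m+1<ν) (step≤1 (s≤s z≤n) j<n)))

  -- Going up from j, ν rises by at most one per step and ends at ν_n ≥ -m - 1, so it meets -m - 1 before -m.
  negScan-starts-with-E : ∀ {m j l} → j + l ≡ suc n → 1 ≤ j → j ≤ n → ν j ℤ.≤ -[1+ m ] →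
    ∃₂ λ t rest → negScan m (ascending j l) ≡ (E , t) ∷ rest
  negScan-starts-with-E {m} {j} {zero} j+0≡ _ j≤n _ =
    ⊥-elim (ℕP.<-irrefl (trans (sym (ℕP.+-identityʳ j)) j+0≡) (s≤s j≤n))
  negScan-starts-with-E {m} {j} {suc l} j+l≡ j≥1 j≤n ν≤ with ≤⇒≡⊎< ν≤ | j ℕP.≟ n
  ... | inj₁ ν≡ | _ = _ , _ , cong (_++ negScan m (ascending (suc j) l)) (letter-E (-m≢-[1+m] m) ν≡)
  ... | inj₂ ν<-m-1 | yes refl = case ℤP.≤-<-trans last≥0 ν<-m-1 of λ ()
  ... | inj₂ ν<-m-1 | no j≢n =
    let j<n = ℕP.≤∧≢⇒< j≤n j≢n
        t , rest , eq = negScan-starts-with-E (trans (sym (ℕP.+-suc j l)) j+l≡) (s≤s z≤n) j<n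
                          (ℤP.≤-trans (step≤1 j≥1 j<n) (ℤP.i<j⇒suc[i]≤j ν<-m-1))
    in t , rest , trans (cong (_++ negScan m (ascending (suc j) l))
                          (letter-none (λ ν≡-m → ℤP.<-asym ν<-m-1 (subst (-[1+ m ] ℤ.<_) (sym ν≡-m) (-[1+m]<-m m)))
                                       (ℤP.<⇒≢ ν<-m-1)))
                        eq
    where
    -[1+m]<-m : ∀ m → -[1+ m ] ℤ.< - + m
    -[1+m]<-m zero    = ℤ.-<+
    -[1+m]<-m (suc m) = ℤ.-<- ℕP.≤-refl

  private
    suc-neg : ∀ {k m} → ν k ≡ -[1+ m ] → ℤ.suc (ν k) ≡ - + m
    suc-neg {m = m} ν≡ = trans (cong ℤ.suc ν≡) (ℤP.1-[1+n]≡-n m)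

  -- the tags of the letters E N that an ascent ν_{k+1} = ν_k + 1 makes adjacent
  data Ascent : Tag → Tag → Set where
    nonneg : ∀ {k} → 1 ≤ k → suc k ≤ n → ν (suc k) ≡ ℤ.suc (ν k) → + 0 ℤ.≤ ν k →
             Ascent (true , suc k) (true , k)
    neg    : ∀ {k} → 1 ≤ k → suc k ≤ n → ν (suc k) ≡ ℤ.suc (ν k) → ν k ℤ.< + 0 →
             Ascent (false , k) (false , suc k)

  data Successor (t : Tag) : List Letter → Set where
    north : ∀ {t′ ys} → Ascent t t′ → Successor t ((N , t′) ∷ ys)
    east  : ∀ {t′ ys} → Successor t ((E , t′) ∷ ys)
    end   : t ≡ (true , 1) → ν 1 ≡ + 1 → Successor t []

  successor-posE : ∀ {k m} → 1 ≤ k → k ≤ n → ν k ≡ + suc m →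
    Successor (true , k) (posScan m (descending (k ∸ 1)) ++ levelsBelow m)
  successor-posE {suc zero} {zero}  _ _ ν≡ = end refl ν≡
  successor-posE {suc zero} {suc m} _ _ ν≡ = case subst (ℤ._≤ + 1) ν≡ first≤1 of λ { (ℤ.+≤+ (s≤s ())) }
  successor-posE {suc (suc k)} {m} _ k<n ν≡ with ≤⇒≡⊎< m≤ν
    where
    m≤ν : + m ℤ.≤ ν (suc k)
    m≤ν = suc-cancel-≤ (subst (ℤ._≤ ℤ.suc (ν (suc k))) ν≡ (step≤1 (s≤s z≤n) k<n))
  ... | inj₁ m≡ν =
    subst (Successor _) (cong (λ l → (l ++ posScan m (descending k)) ++ levelsBelow m) (sym (letter-N (sym m≡ν))))
      (north (nonneg (s≤s z≤n) k<n (trans ν≡ (cong ℤ.suc m≡ν)) (subst (+ 0 ℤ.≤_) m≡ν (ℤ.+≤+ z≤n))))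
  ... | inj₂ m<ν =
    let _ , _ , eq = posScan-starts-with-E (s≤s z≤n) (ℕP.<⇒≤ k<n) (ℤP.i<j⇒suc[i]≤j m<ν)
    in subst (Successor _) (cong (_++ levelsBelow m) (sym eq)) east

  successor-negE : ∀ {k m} → 1 ≤ k → k ≤ n → ν k ≡ -[1+ m ] →
    Successor (false , k) ((negScan m (ascending (suc k) (n ∸ k)) ++ posScan m (descending n)) ++ levelsBelow m)
  successor-negE {k} {m} k≥1 k≤n ν≡ with k ℕP.≟ n
  ... | yes refl = case subst (+ 0 ℤ.≤_) ν≡ last≥0 of λ ()
  ... | no k≢n with ℕP.≤∧≢⇒< k≤n k≢n
  ...   | k<n with ≤⇒≡⊎< (subst (ν (suc k) ℤ.≤_) (suc-neg ν≡) (step≤1 k≥1 k<n))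
  ...     | inj₁ ν′≡-m =
    subst (Successor _)
      (cong (λ l → (l ++ posScan m (descending n)) ++ levelsBelow m)
        (sym (trans (cong (negScan m) (ascending-∷ k<n))
                    (cong (_++ negScan m (ascending (2 + k) (n ∸ suc k))) (letter-N ν′≡-m)))))
      (north (neg k≥1 k<n (trans ν′≡-m (sym (suc-neg ν≡)))
                          (subst (ℤ._< + 0) (sym ν≡) ℤ.-<+)))
  ...     | inj₂ ν′<-m =
    let _ , _ , eq = negScan-starts-with-E (cong suc (ℕP.m+[n∸m]≡n k≤n)) (s≤s z≤n) k<n
                       (suc-cancel-≤ (subst (ℤ.suc (ν (suc k)) ℤ.≤_) (sym (ℤP.1-[1+n]≡-n m))
                                            (ℤP.i<j⇒suc[i]≤j ν′<-m)))
    in subst (Successor _) (cong (λ l → (l ++ posScan m (descending n)) ++ levelsBelow m) (sym eq)) east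

  successor : ∀ {t} → (E , t) ∈ word → ∃ λ ys → Once (E , t) word ys × Successor t ys
  successor E∈ with ∈-concatMap level (downFrom (suc n)) E∈
  ... | m , _ , E∈level with ∈P.∈-++⁻ (negScan m (ascending 1 n)) E∈level
  ...   | inj₁ E∈neg with ∈-concatMap (negLetter m) (ascending 1 n) E∈neg
  ...     | j , j∈ , E∈letter with ∈E-negLetter E∈letter | ∈-ascending 1 n j∈
  ...       | refl , ν≡ | j≥1 , j<1+n =
    _ , once-negE j≥1 (ℕP.≤-pred j<1+n) ν≡ , successor-negE j≥1 (ℕP.≤-pred j<1+n) ν≡
  successor E∈ | m , _ , E∈level | inj₂ E∈pos with ∈-concatMap (posLetter m) (descending n) E∈pos
  ...     | j , j∈ , E∈letter with ∈E-posLetter E∈letter | ∈-descending n j∈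
  ...       | refl , ν≡ | j≥1 , j≤n = _ , once-posE j≥1 j≤n ν≡ , successor-posE j≥1 j≤n ν≡

  private
    E∈word : ∀ pre {t} post → word ≡ pre ++ (E , t) ∷ post → (E , t) ∈ word
    E∈word pre post split = subst (_ ∈_) (sym split) (∈P.∈-++⁺ʳ pre (here refl))

  E-followed-by-N⇒Ascent : ∀ pre {t t′} post → word ≡ pre ++ (E , t) ∷ (N , t′) ∷ post → Ascent t t′
  E-followed-by-N⇒Ascent pre post split with successor (E∈word pre _ split)
  ... | ys , occ , succ with once-suffix occ pre _ split | succ
  ... | refl | north ascent = ascent

  E-at-end : ∀ pre {t} → word ≡ pre ++ (E , t) ∷ [] → t ≡ (true , 1) × ν 1 ≡ + 1
  E-at-end pre split with successor (E∈word pre [] split)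
  ... | ys , occ , succ with once-suffix occ pre [] split | succ
  ... | refl | end t≡ ν≡ = t≡ , ν≡

  Ascent⇒E-followed-by-N : ∀ {t t′} → Ascent t t′ → ∃₂ λ pre post → word ≡ pre ++ (E , t) ∷ (N , t′) ∷ post
  Ascent⇒E-followed-by-N (nonneg {suc k} _ k<n rise 0≤ν) =
    let m , ν≡ = nonneg-form 0≤ν
        once pre split _ _ = once-posE (s≤s z≤n) k<n (trans rise (cong ℤ.suc ν≡))
    in pre , _ , trans split (cong (λ l → pre ++ (E , true , suc (suc k)) ∷ ((l ++ posScan m (descending k)) ++ levelsBelow m))
                                  (letter-N ν≡))
  Ascent⇒E-followed-by-N (neg {k} k≥1 k<n rise ν<0) =
    let m , ν≡ = neg-form ν<0
        once pre split _ _ = once-negE k≥1 (ℕP.<⇒≤ k<n) ν≡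
    in pre , _ , trans split (cong (λ l → pre ++ (E , false , k) ∷ ((l ++ posScan m (descending n)) ++ levelsBelow m))
                                  (trans (cong (negScan m) (ascending-∷ k<n))
                                         (cong (_++ negScan m (ascending (2 + k) (n ∸ suc k)))
                                               (letter-N (trans rise (suc-neg ν≡))))))

  ν₁≡1⇒E-at-end : ν 1 ≡ + 1 → ∃ λ pre → word ≡ pre ++ (E , true , 1) ∷ []
  ν₁≡1⇒E-at-end ν≡ = let once pre split _ _ = once-posE (s≤s z≤n) n≥1 ν≡ in pre , split

  scanTags : Bool → ℤ → List ℕ → List Tag
  scanTags b v = concatMap (λ j → onlyIf (does (ν j ℤ.≟ v)) (b , j))

  reverse-scanTags : ∀ b v js → reverse (scanTags b v js) ≡ scanTags b v (reverse js)
  reverse-scanTags b v = reverse-concatMap-onlyIf _ _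

  Es-negScan : ∀ m js → Es (negScan m js) ≡ scanTags false -[1+ m ] js
  Es-negScan m js = trans (concatMap-concatMap eTag (negLetter m) js)
                          (LP.concatMap-cong (λ j → Es-letter {t = false , j} {ν j} (-m≢-[1+m] m)) js)

  Es-posScan : ∀ m js → Es (posScan m js) ≡ scanTags true (+ suc m) js
  Es-posScan m js = trans (concatMap-concatMap eTag (posLetter m) js)
                          (LP.concatMap-cong (λ j → Es-letter {t = true , j} {ν j} (+m≢+[1+m] m)) js)

  Ns-negScan : ∀ m js → Ns (negScan m js) ≡ scanTags false (- + m) js
  Ns-negScan m js = trans (concatMap-concatMap nTag (negLetter m) js)
                          (LP.concatMap-cong (λ j → Ns-letter { - + m} { -[1+ m ]} {false , j} {ν j}) js)

  Ns-posScan : ∀ m js → Ns (posScan m js) ≡ scanTags true (+ m) js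
  Ns-posScan m js = trans (concatMap-concatMap nTag (posLetter m) js)
                          (LP.concatMap-cong (λ j → Ns-letter {+ m} {+ suc m} {true , j} {ν j}) js)

  -- d_C(π,u) with each entry ±u(j) replaced by its tag
  negTags posTags : ℕ → List Tag
  negTags i = scanTags false (- + i) (descending n)
  posTags i = scanTags true (+ suc i) (ascending 1 n)

  dTags : List Tag
  dTags = concatMap (λ i → negTags i ++ posTags i) (upTo (suc n))

  private
    reverse-negTags : ∀ i → reverse (negTags i) ≡ scanTags false (- + i) (ascending 1 n)
    reverse-negTags i = trans (reverse-scanTags false (- + i) (descending n)) (cong (scanTags false (- + i)) (reverse-descending n))

    reverse-posTags : ∀ i → reverse (posTags i) ≡ scanTags true (+ suc i) (descending n)
    reverse-posTags i = trans (reverse-scanTags true (+ suc i) (ascending 1 n)) (cong (scanTags true (+ suc i)) (reverse-ascending n))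

  Es-level : ∀ m → Es (level m) ≡ reverse (negTags (suc m)) ++ reverse (posTags m)
  Es-level m = begin
    Es (negScan m (ascending 1 n) ++ posScan m (descending n))
      ≡⟨ LP.concatMap-++ eTag (negScan m (ascending 1 n)) _ ⟩
    Es (negScan m (ascending 1 n)) ++ Es (posScan m (descending n))
      ≡⟨ cong₂ _++_ (Es-negScan m (ascending 1 n)) (Es-posScan m (descending n)) ⟩
    scanTags false -[1+ m ] (ascending 1 n) ++ scanTags true (+ suc m) (descending n)
      ≡⟨ cong₂ _++_ (reverse-negTags (suc m)) (reverse-posTags m) ⟨
    reverse (negTags (suc m)) ++ reverse (posTags m) ∎
    where open ≡-Reasoning

  Ns-level : ∀ m → Ns (level m) ≡ reverse (negTags m) ++ scanTags true (+ m) (descending n)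
  Ns-level m = begin
    Ns (negScan m (ascending 1 n) ++ posScan m (descending n))
      ≡⟨ LP.concatMap-++ nTag (negScan m (ascending 1 n)) _ ⟩
    Ns (negScan m (ascending 1 n)) ++ Ns (posScan m (descending n))
      ≡⟨ cong₂ _++_ (trans (Ns-negScan m (ascending 1 n)) (sym (reverse-negTags m))) (Ns-posScan m (descending n)) ⟩
    reverse (negTags m) ++ scanTags true (+ m) (descending n) ∎
    where open ≡-Reasoning

  negTags-top : negTags (suc n) ≡ []
  negTags-top = concatMap-onlyIf-none _ _ (descending n) λ j∈ →
    let j≥1 , j≤n = ∈-descending n j∈
    in dec-false (_ ℤ.≟ _) λ ν≡ →
         ℕP.<-irrefl refl (ℤP.drop‿+≤+ (ℤP.neg-cancel-≤ {+ n} {+ suc n}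
           (subst (- + n ℤ.≤_) ν≡ (proj₁ (bounded j≥1 j≤n)))))

  posTags-top : posTags n ≡ []
  posTags-top = concatMap-onlyIf-none _ _ (ascending 1 n) λ j∈ →
    let j≥1 , j<1+n = ∈-ascending 1 n j∈
    in dec-false (_ ℤ.≟ _) λ ν≡ →
         ℕP.<-irrefl refl (ℤP.drop‿+≤+ (subst (ℤ._≤ + n) ν≡ (proj₂ (bounded j≥1 (ℕP.≤-pred j<1+n)))))

  reverse-dTags : reverse dTags ≡ concatMap (λ i → reverse (posTags i) ++ reverse (negTags i)) (downFrom (suc n))
  reverse-dTags = begin
    reverse dTags
      ≡⟨ reverse-concatMap (λ i → negTags i ++ posTags i) (upTo (suc n)) ⟩
    concatMap (λ i → reverse (negTags i ++ posTags i)) (reverse (upTo (suc n)))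
      ≡⟨ LP.concatMap-cong (λ i → LP.reverse-++ (negTags i) (posTags i)) (reverse (upTo (suc n))) ⟩
    concatMap (λ i → reverse (posTags i) ++ reverse (negTags i)) (reverse (upTo (suc n)))
      ≡⟨ cong (concatMap (λ i → reverse (posTags i) ++ reverse (negTags i))) (LP.reverse-upTo (suc n)) ⟩
    concatMap (λ i → reverse (posTags i) ++ reverse (negTags i)) (downFrom (suc n)) ∎
    where open ≡-Reasoning

  Es-word : Es word ++ reverse (negTags 0) ≡ reverse dTags
  Es-word = begin
    Es word ++ reverse (negTags 0)
      ≡⟨ cong (_++ reverse (negTags 0)) (trans (concatMap-concatMap eTag level (downFrom (suc n)))
                                               (LP.concatMap-cong Es-level (downFrom (suc n)))) ⟩
    concatMap (λ m → reverse (negTags (suc m)) ++ reverse (posTags m)) (downFrom (suc n)) ++ reverse (negTags 0)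
      ≡⟨ concatMap-telescope (reverse ∘ posTags) (reverse ∘ negTags) (suc n) ⟩
    reverse (negTags (suc n)) ++ concatMap (λ i → reverse (posTags i) ++ reverse (negTags i)) (downFrom (suc n))
      ≡⟨ cong (λ l → reverse l ++ concatMap (λ i → reverse (posTags i) ++ reverse (negTags i)) (downFrom (suc n)))
              negTags-top ⟩
    concatMap (λ i → reverse (posTags i) ++ reverse (negTags i)) (downFrom (suc n))
      ≡⟨ reverse-dTags ⟨
    reverse dTags ∎
    where open ≡-Reasoning

  Ns-word : Ns word ≡ reverse dTags ++ map flip (negTags 0)
  Ns-word = begin
    Ns word
      ≡⟨ trans (concatMap-concatMap nTag level (downFrom (suc n))) (LP.concatMap-cong Ns-level (downFrom (suc n))) ⟩
    concatMap (λ m → reverse (negTags m) ++ P m) (downFrom (suc n))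
      ≡⟨ cong (_++ concatMap (λ m → reverse (negTags m) ++ P m) (downFrom (suc n)))
              (trans (sym (reverse-posTags n)) (cong reverse posTags-top)) ⟨
    P (suc n) ++ concatMap (λ m → reverse (negTags m) ++ P m) (downFrom (suc n))
      ≡⟨ concatMap-telescope (reverse ∘ negTags) P (suc n) ⟨
    concatMap (λ i → P (suc i) ++ reverse (negTags i)) (downFrom (suc n)) ++ P 0
      ≡⟨ cong₂ _++_ (LP.concatMap-cong (λ i → cong (_++ reverse (negTags i)) (sym (reverse-posTags i))) (downFrom (suc n)))
                    P0≡ ⟩
    concatMap (λ i → reverse (posTags i) ++ reverse (negTags i)) (downFrom (suc n)) ++ map flip (negTags 0)
      ≡⟨ cong (_++ map flip (negTags 0)) reverse-dTags ⟨
    reverse dTags ++ map flip (negTags 0) ∎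
    where
    open ≡-Reasoning
    P : ℕ → List Tag
    P m = scanTags true (+ m) (descending n)
    P0≡ : P 0 ≡ map flip (negTags 0)
    P0≡ = sym (trans (LP.map-concatMap flip _ (descending n))
                     (LP.concatMap-cong (λ j → map-onlyIf flip _ (false , j)) (descending n)))

  private
    length-level-tags : ∀ i → length (negTags i ++ posTags i) ≡ sum (map (λ j → hits (ν j) i) (ascending 1 n))
    length-level-tags i = begin
      length (negTags i ++ posTags i)
        ≡⟨ LP.length-++ (negTags i) ⟩
      length (negTags i) + length (posTags i)
        ≡⟨ cong₂ _+_ (length-concatMap-onlyIf _ _ (descending n)) (length-concatMap-onlyIf _ _ (ascending 1 n)) ⟩
      sum (map isNeg (descending n)) + sum (map isPos (ascending 1 n))
        ≡⟨ cong (λ l → sum (map isNeg l) + sum (map isPos (ascending 1 n))) (reverse-ascending n) ⟨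
      sum (map isNeg (reverse (ascending 1 n))) + sum (map isPos (ascending 1 n))
        ≡⟨ cong (_+ sum (map isPos (ascending 1 n))) (sum-map-reverse isNeg (ascending 1 n)) ⟩
      sum (map isNeg (ascending 1 n)) + sum (map isPos (ascending 1 n))
        ≡⟨ sum-map-+ isNeg isPos (ascending 1 n) ⟨
      sum (map (λ j → hits (ν j) i) (ascending 1 n)) ∎
      where
      open ≡-Reasoning
      isNeg isPos : ℕ → ℕ
      isNeg j = iverson (does (ν j ℤ.≟ - + i))
      isPos j = iverson (does (ν j ℤ.≟ + suc i))

  length-dTags : length dTags ≡ n
  length-dTags = begin
    length dTags
      ≡⟨ length-concatMap (λ i → negTags i ++ posTags i) (upTo (suc n)) ⟩
    sum (map (λ i → length (negTags i ++ posTags i)) (upTo (suc n)))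
      ≡⟨ cong sum (LP.map-cong length-level-tags (upTo (suc n))) ⟩
    sum (map (λ i → sum (map (λ j → hits (ν j) i) (ascending 1 n))) (upTo (suc n)))
      ≡⟨ sum-swap (λ i j → hits (ν j) i) (upTo (suc n)) (ascending 1 n) ⟩
    sum (map (λ j → sum (map (hits (ν j)) (upTo (suc n)))) (ascending 1 n))
      ≡⟨ cong sum (LP.map-cong-local (All.tabulate λ j∈ →
           let j≥1 , j<1+n = ∈-ascending 1 n j∈ in uncurry sum-hits (bounded j≥1 (ℕP.≤-pred j<1+n)))) ⟩
    sum (map (λ _ → 1) (ascending 1 n))
      ≡⟨ sum-map-1 (ascending 1 n) ⟩
    length (ascending 1 n)
      ≡⟨ length-ascending 1 n ⟩
    n ∎
    where open ≡-Reasoning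

  length-Ns-word : length (Ns word) ≡ n + length (negTags 0)
  length-Ns-word = trans (cong length Ns-word)
    (trans (LP.length-++ (reverse dTags))
           (cong₂ _+_ (trans (LP.length-reverse dTags) length-dTags) (LP.length-map flip (negTags 0))))

  E-at-end⇒dTags : ∀ pre {t} → word ≡ pre ++ (E , t) ∷ [] → dTags ≡ negTags 0 ++ t ∷ reverse (Es pre)
  E-at-end⇒dTags pre {t} split = begin
    dTags                                                 ≡⟨ LP.reverse-involutive dTags ⟨
    reverse (reverse dTags)                               ≡⟨ cong reverse Es-word ⟨
    reverse (Es word ++ reverse (negTags 0))
      ≡⟨ cong (λ l → reverse (l ++ reverse (negTags 0))) (trans (cong Es split) (Es-++-E pre t [])) ⟩
    reverse ((Es pre ++ t ∷ []) ++ reverse (negTags 0))   ≡⟨ cong reverse (LP.++-assoc (Es pre) (t ∷ []) _) ⟩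
    reverse (Es pre ++ t ∷ reverse (negTags 0))           ≡⟨ reverse-++-∷ (Es pre) t _ ⟩
    reverse (reverse (negTags 0)) ++ t ∷ reverse (Es pre)
      ≡⟨ cong (_++ t ∷ reverse (Es pre)) (LP.reverse-involutive (negTags 0)) ⟩
    negTags 0 ++ t ∷ reverse (Es pre)                     ∎
    where open ≡-Reasoning

  module Labels (val : Tag → ℤ) (val-flip : ∀ t → val (flip t) ≡ - val t) where

    d : List ℤ
    d = map val dTags

    private
      length-reverse-dTags : length (reverse dTags) ≡ n
      length-reverse-dTags = trans (LP.length-reverse dTags) length-dTags

      entry-from-end : ∀ xs t ys → reverse dTags ≡ xs ++ t ∷ ys → uAt d (n ∸ length xs) ≡ val t
      entry-from-end xs t ys rev≡ =
        subst (λ k → uAt d (k ∸ length xs) ≡ val t) length-dTags (uAt-map-from-end val dTags xs t ys rev≡)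

      map-flip-flip : ∀ ts → map flip (map flip ts) ≡ ts
      map-flip-flip []             = refl
      map-flip-flip ((b , j) ∷ ts) = cong₂ _∷_ (cong (_, j) (not-involutive b)) (map-flip-flip ts)

      entry-from-start : ∀ xs t ys → map flip (negTags 0) ≡ xs ++ t ∷ ys → - uAt d (suc (length xs)) ≡ val t
      entry-from-start xs t ys flips≡ = begin
        - uAt d (suc (length xs))             ≡⟨ cong (λ k → - uAt d (suc k)) (LP.length-map flip xs) ⟨
        - uAt d (suc (length (map flip xs)))
          ≡⟨ cong -_ (uAt-map-from-start val (map flip xs) (flip t) (map flip ys ++ rest) dTags≡) ⟩
        - val (flip t)                        ≡⟨ cong -_ (val-flip t) ⟩
        - - val t                             ≡⟨ ℤP.neg-involutive (val t) ⟩
        val t                                 ∎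
        where
        open ≡-Reasoning
        rest = posTags 0 ++ concatMap (λ i → negTags i ++ posTags i) (applyUpTo suc n)
        negTags≡ : negTags 0 ≡ map flip xs ++ flip t ∷ map flip ys
        negTags≡ = trans (sym (map-flip-flip (negTags 0))) (trans (cong (map flip) flips≡) (LP.map-++ flip xs (t ∷ ys)))
        dTags≡ : dTags ≡ map flip xs ++ flip t ∷ (map flip ys ++ rest)
        dTags≡ = trans (LP.++-assoc (negTags 0) (posTags 0) _)
                       (trans (cong (_++ rest) negTags≡) (LP.++-assoc (map flip xs) (flip t ∷ map flip ys) rest))

    east-coordinate : ∀ xs t ys j → Es word ≡ xs ++ t ∷ ys → proj₁ (valleyLabel n d (suc (length xs) , j)) ≡ val t
    east-coordinate xs t ys j Es≡ =
      trans (proj₁-valleyLabel n d (suc (length xs)) j) (entry-from-end xs t (ys ++ reverse (negTags 0)) rev≡)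
      where
      rev≡ : reverse dTags ≡ xs ++ t ∷ (ys ++ reverse (negTags 0))
      rev≡ = trans (sym Es-word) (trans (cong (_++ reverse (negTags 0)) Es≡) (LP.++-assoc xs (t ∷ ys) _))

    north-coordinate : ∀ i xs t ys → Ns word ≡ xs ++ t ∷ ys → proj₂ (valleyLabel n d (i , suc (length xs))) ≡ val t
    north-coordinate i xs t ys Ns≡ with length xs ℕP.<? n | trans (sym Ns≡) Ns-word
    ... | yes f<n | split≡ =
      let ys′ , rev≡ = ++-∷-split-< xs t ys (reverse dTags) _ split≡ (subst (length xs <_) (sym length-reverse-dTags) f<n)
      in trans (proj₂-valleyLabel-< n d i f<n) (entry-from-end xs t ys′ rev≡)
    ... | no f≮n | split≡ =
      let n≤f = ℕP.≮⇒≥ f≮n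
          xs′ , flips≡ , length≡ = ++-∷-split-≥ xs t ys (reverse dTags) (map flip (negTags 0)) split≡
                                     (subst (_≤ length xs) (sym length-reverse-dTags) n≤f)
          f∸n≡ : length xs ∸ n ≡ length xs′
          f∸n≡ = trans (cong (_∸ n) (trans length≡ (cong (_+ length xs′) length-reverse-dTags)))
                       (ℕP.m+n∸m≡n n (length xs′))
      in trans (proj₂-valleyLabel-≥ n d i n≤f)
               (trans (cong (λ k → - uAt d (suc k)) f∸n≡) (entry-from-start xs′ t ys flips≡))

    valley-label : ∀ pre {t t′} post → word ≡ pre ++ (E , t) ∷ (N , t′) ∷ post →
      valleyLabel n d (suc (length (Es pre)) , suc (length (Ns pre))) ≡ (val t , val t′)
    valley-label pre {t} {t′} post split = ×-≡,≡→≡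
      ( east-coordinate (Es pre) t (Es post) (suc (length (Ns pre))) (trans (cong Es split) (Es-++-E pre t _))
      , north-coordinate (suc (length (Es pre))) (Ns pre) t′ (Ns post) (trans (cong Ns split) (Ns-++-E-N pre t t′ post)) )

    end-label : ∀ pre {t} → word ≡ pre ++ (E , t) ∷ [] →
      valleyLabel n d (length (Es word) , suc (length (Ns word))) ≡ (val t , - val t)
    end-label pre {t} split = ×-≡,≡→≡
      ( trans (cong (λ i → proj₁ (valleyLabel n d (i , suc (length (Ns word))))) length-Es≡)
              (east-coordinate (Es pre) t [] (suc (length (Ns word))) Es≡)
      , (begin
          proj₂ (valleyLabel n d (length (Es word) , suc (length (Ns word))))
            ≡⟨ proj₂-valleyLabel-≥ n d (length (Es word))
                 (subst (n ≤_) (sym length-Ns-word) (ℕP.m≤m+n n (length (negTags 0)))) ⟩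
          - uAt d (suc (length (Ns word) ∸ n))
            ≡⟨ cong (λ k → - uAt d (suc (k ∸ n))) length-Ns-word ⟩
          - uAt d (suc (n + length (negTags 0) ∸ n))
            ≡⟨ cong (λ k → - uAt d (suc k)) (ℕP.m+n∸m≡n n (length (negTags 0))) ⟩
          - uAt d (suc (length (negTags 0)))
            ≡⟨ cong -_ (uAt-map-from-start val (negTags 0) t (reverse (Es pre)) (E-at-end⇒dTags pre split)) ⟩
          - val t ∎) )
      where
      open ≡-Reasoning
      Es≡ : Es word ≡ Es pre ++ t ∷ []
      Es≡ = trans (cong Es split) (Es-++-E pre t [])
      length-Es≡ : length (Es word) ≡ suc (length (Es pre))
      length-Es≡ = trans (cong length Es≡) (trans (LP.length-++ (Es pre)) (ℕP.+-comm (length (Es pre)) 1))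

-- The vertex (π , u)

module Vertex {n : ℕ} (n≥1 : 1 ≤ n) {π : Path} {u : List ℤ} (vert : InVert n π u) where

  private
    countE≡n : countE π ≡ n
    countE≡n = proj₁ (proj₁ vert)

    countN≡n : countN π ≡ n
    countN≡n = proj₂ (proj₁ vert)

    lam≤n : ∀ j → lam π j ≤ n
    lam≤n j = subst (lam π j ≤_) countE≡n (lam≤countE π j)

  open SignedPerm (proj₁ (proj₂ vert))

  ν : ℕ → ℤ
  ν j = mu n π (suc n ∸ j)

  ν≡ : ∀ {j} → j ≤ n → ν j ≡ j ⊖ lam π j
  ν≡ {j} j≤n = trans (cong (λ k → + k ℤ.- + lam π k) (ℕP.m∸[m∸n]≡n (ℕP.m≤n⇒m≤1+n j≤n)))
                     (ℤP.[+m]-[+n]≡m⊖n j (lam π j))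

  suc-ν≡ : ∀ {j} → j ≤ n → ℤ.suc (ν j) ≡ suc j ⊖ lam π j
  suc-ν≡ {j} j≤n = trans (cong ℤ.suc (ν≡ j≤n)) (ℤP.distribʳ-⊖-+-pos 1 j (lam π j))

  heights : Heights n ν
  heights = record
    { n≥1     = n≥1
    ; step≤1  = λ {j} j≥1 j<n → subst₂ ℤ._≤_ (sym (ν≡ j<n)) (sym (suc-ν≡ (ℕP.<⇒≤ j<n)))
                                   (ℤP.⊖-monoʳ-≥-≤ (suc j) (lam-mono π j≥1))
    ; first≤1 = subst (ℤ._≤ + 1) (sym (ν≡ n≥1)) (ℤP.m⊖n≤m 1 (lam π 1))
    ; last≥0  = subst (+ 0 ℤ.≤_) (sym (trans (ν≡ ℕP.≤-refl) (ℤP.⊖-≥ (lam≤n n)))) (ℤ.+≤+ z≤n)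
    ; bounded = λ {j} _ j≤n → subst (λ x → - + n ℤ.≤ x × x ℤ.≤ + n) (sym (ν≡ j≤n))
        ( ℤP.≤-trans (ℤP.neg-mono-≤ (ℤ.+≤+ (lam≤n j)))
                     (subst (ℤ._≤ j ⊖ lam π j) (0⊖≡- (lam π j)) (ℤP.⊖-monoˡ-≤ (lam π j) z≤n))
        , ℤP.≤-trans (ℤP.m⊖n≤m j (lam π j)) (ℤ.+≤+ j≤n) )
    }

  open Word heights

  val : Tag → ℤ
  val (true  , j) = uAt u j
  val (false , j) = - uAt u j

  val-flip : ∀ t → val (flip t) ≡ - val t
  val-flip (true  , j) = refl
  val-flip (false , j) = sym (ℤP.neg-involutive (uAt u j))

  open Labels val val-flip

  zetaC≡ : zetaC n π ≡ shape word
  zetaC≡ = begin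
    concatMap (λ m → S⃖⁻ m (muVec n π) ++ S⃗⁺ m (muVec n π)) (downFrom (suc n))
      ≡⟨ LP.concatMap-cong level≡ (downFrom (suc n)) ⟩
    concatMap (shape ∘ level) (downFrom (suc n))
      ≡⟨ LP.map-concatMap proj₁ level (downFrom (suc n)) ⟨
    shape word ∎
    where
    open ≡-Reasoning
    reverse-muVec : reverse (muVec n π) ≡ map ν (ascending 1 n)
    reverse-muVec = begin
      reverse (map (mu n π) (oneTo n))              ≡⟨ LP.reverse-map (mu n π) (oneTo n) ⟨
      map (mu n π) (reverse (oneTo n))
        ≡⟨ cong (map (mu n π)) (trans (reverse-oneTo n) (sym (map-∸-ascending n 1))) ⟩
      map (mu n π) (map (suc n ∸_) (ascending 1 n)) ≡⟨ LP.map-∘ (ascending 1 n) ⟨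
      map ν (ascending 1 n)                         ∎
    muVec≡ : muVec n π ≡ map ν (descending n)
    muVec≡ = begin
      muVec n π                         ≡⟨ LP.reverse-involutive (muVec n π) ⟨
      reverse (reverse (muVec n π))     ≡⟨ cong reverse reverse-muVec ⟩
      reverse (map ν (ascending 1 n))   ≡⟨ LP.reverse-map ν (ascending 1 n) ⟨
      map ν (reverse (ascending 1 n))   ≡⟨ cong (map ν) (reverse-ascending n) ⟩
      map ν (descending n)              ∎
    level≡ : ∀ m → S⃖⁻ m (muVec n π) ++ S⃗⁺ m (muVec n π) ≡ shape (level m)
    level≡ m = trans (cong₂ _++_ (trans (cong (readS (- + m) (- + suc m)) reverse-muVec)
                                        (readS≡shape (- + m) (- + suc m) false ν (ascending 1 n)))
                                 (trans (cong (readS (+ m) (+ suc m)) muVec≡)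
                                        (readS≡shape (+ m) (+ suc m) true ν (descending n))))
                     (sym (LP.map-++ proj₁ (negScan m (ascending 1 n)) (posScan m (descending n))))

  dC≡ : dC n π u ≡ d
  dC≡ = sym (trans (LP.map-concatMap val _ (upTo (suc n))) (LP.concatMap-cong level≡ (upTo (suc n))))
    where
    map-val-scanTags : ∀ b v js →
      map val (scanTags b v js) ≡ concatMap (λ j → onlyIf (does (ν j ℤ.≟ v)) (val (b , j))) js
    map-val-scanTags b v js = trans (LP.map-concatMap val _ js) (LP.concatMap-cong (λ j → map-onlyIf val _ (b , j)) js)
    level≡ : ∀ i → map val (negTags i ++ posTags i)
                 ≡ concatMap (λ j → onlyIf (does (ν j ℤ.≟ - + i)) (- uAt u j)) (reverse (oneTo n))
                   ++ concatMap (λ j → onlyIf (does (ν j ℤ.≟ + suc i)) (uAt u j)) (oneTo n)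
    level≡ i = trans (LP.map-++ val (negTags i) (posTags i)) (cong₂ _++_
      (trans (map-val-scanTags false (- + i) (descending n)) (cong (concatMap _) (sym (reverse-oneTo n))))
      (trans (map-val-scanTags true (+ suc i) (ascending 1 n)) (cong (concatMap _) (sym (oneTo≡ascending n)))))

  ascent⇔flat : ∀ {k} → suc k ≤ n → (ν (suc k) ≡ ℤ.suc (ν k)) ⇔ (lam π (suc k) ≡ lam π k)
  ascent⇔flat {k} k<n = mk⇔
    (λ ascent → ⊖-cancelˡ (suc k) (trans (sym (ν≡ k<n)) (trans ascent (suc-ν≡ (ℕP.<⇒≤ k<n)))))
    (λ flat → trans (ν≡ k<n) (trans (cong (suc k ⊖_) flat) (sym (suc-ν≡ (ℕP.<⇒≤ k<n)))))

  IsRise⇒Ascent : ∀ {i} → IsRise π i → Ascent (true , suc i) (true , i) ⊎ Ascent (false , i) (false , suc i)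
  IsRise⇒Ascent {i} rise with IsRise⇒lam-flat π i rise | + 0 ℤ.≤? ν i
  ... | i≥1 , i<countN , flat | yes 0≤ν = inj₁ (nonneg i≥1 i<n (Equivalence.from (ascent⇔flat i<n) flat) 0≤ν)
    where i<n = subst (suc i ≤_) countN≡n i<countN
  ... | i≥1 , i<countN , flat | no  0≰ν =
    inj₂ (neg i≥1 i<n (Equivalence.from (ascent⇔flat i<n) flat) (ℤP.≰⇒> 0≰ν))
    where i<n = subst (suc i ≤_) countN≡n i<countN

  ascent⇒IsRise : ∀ {k} → 1 ≤ k → suc k ≤ n → ν (suc k) ≡ ℤ.suc (ν k) → IsRise π k
  ascent⇒IsRise {k} k≥1 k<n ascent =
    lam-flat⇒IsRise π k k≥1 (subst (suc k ≤_) (sym countN≡n) k<n) (Equivalence.to (ascent⇔flat k<n) ascent)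

  head≡N⇔ν₁≡1 : (head π ≡ just N) ⇔ (ν 1 ≡ + 1)
  head≡N⇔ν₁≡1 = mk⇔
    (λ hN → trans (ν≡ n≥1) (cong (1 ⊖_) (head≡N⇒lam₁≡0 π hN)))
    (λ ν₁≡1 → lam₁≡0⇒head≡N π (subst (1 ≤_) (sym countN≡n) n≥1)
                                (⊖-cancelˡ 1 (trans (sym (ν≡ n≥1)) ν₁≡1)))

  VL : ℕ × ℕ → ℤ × ℤ
  VL = valleyLabel n (dC n π u)

  VL≡ : ∀ v → VL v ≡ valleyLabel n d v
  VL≡ v = cong (λ w → valleyLabel n w v) dC≡

  valley-cases : ∀ {v} → IsValley (zetaC n π) v →
      (∃₂ λ t t′ → Ascent t t′ × VL v ≡ (val t , val t′))
    ⊎ (head π ≡ just N × VL v ≡ (uAt u 1 , - uAt u 1))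
  valley-cases {v} isV with IsValley⇒split word (subst (λ ζ → IsValley ζ v) zetaC≡ isV)
  ... | inj₁ (pre , t , t′ , post , split , refl) =
    inj₁ (t , t′ , E-followed-by-N⇒Ascent pre post split
         , trans (VL≡ (suc (length (Es pre)) , suc (length (Ns pre)))) (valley-label pre post split))
  ... | inj₂ (pre , t , split , refl) with E-at-end pre split
  ...   | refl , ν₁≡1 =
    inj₂ ( Equivalence.from head≡N⇔ν₁≡1 ν₁≡1
         , trans (VL≡ (length (Es word) , suc (length (Ns word)))) (end-label pre split))

  Ascent⇒valley : ∀ {t t′} → Ascent t t′ → ∃ λ v → IsValley (zetaC n π) v × VL v ≡ (val t , val t′)
  Ascent⇒valley ascent =
    let pre , post , split = Ascent⇒E-followed-by-N ascent
        v = (suc (length (Es pre)) , suc (length (Ns pre)))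
    in v , subst (λ ζ → IsValley ζ v) (sym zetaC≡) (split⇒IsValley word pre post split)
         , trans (VL≡ v) (valley-label pre post split)

  head≡N⇒valley : head π ≡ just N → ∃ λ v → IsValley (zetaC n π) v × VL v ≡ (uAt u 1 , - uAt u 1)
  head≡N⇒valley hN =
    let pre , split = ν₁≡1⇒E-at-end (Equivalence.to head≡N⇔ν₁≡1 hN)
        v = (length (Es word) , suc (length (Ns word)))
    in v , subst (λ ζ → IsValley ζ v) (sym zetaC≡) (end⇒IsValley word pre split)
         , trans (VL≡ v) (end-label pre split)

  private
    member≢-opposite : ∀ {a k} → a ∈ u → 1 ≤ k → k ≤ n → a ≢ - uAt u k
    member≢-opposite a∈u k≥1 k≤n a≡ =
      let j , j≥1 , j≤n , uj≡a = index a∈u in no-opposite j≥1 j≤n k≥1 k≤n (trans uj≡a a≡)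

    entry≢-opposite : ∀ {a k} → a ∈ u → 1 ≤ k → k ≤ n → uAt u k ≢ - a
    entry≢-opposite a∈u k≥1 k≤n uk≡ =
      let j , j≥1 , j≤n , uj≡a = index a∈u in no-opposite k≥1 k≤n j≥1 j≤n (trans uk≡ (cong -_ (sym uj≡a)))

  rise⇒valley : ∀ {a b} → (∃ λ i → IsRise π i × riseLabel u i ≡ (a , b)) →
    ∃ λ v → IsValley (zetaC n π) v × (VL v ≡ (b , a) ⊎ VL v ≡ (- a , - b))
  rise⇒valley (i , rise , refl) with IsRise⇒Ascent rise
  ... | inj₁ ascent = let v , isV , lab = Ascent⇒valley ascent in v , isV , inj₁ lab
  ... | inj₂ ascent = let v , isV , lab = Ascent⇒valley ascent in v , isV , inj₂ lab

  valley⇒rise : ∀ {a b} → a ∈ u → b ∈ u →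
    (∃ λ v → IsValley (zetaC n π) v × (VL v ≡ (b , a) ⊎ VL v ≡ (- a , - b))) →
    ∃ λ i → IsRise π i × riseLabel u i ≡ (a , b)
  valley⇒rise a∈u b∈u (v , isV , lab) with valley-cases isV | lab
  ... | inj₁ (_ , _ , nonneg {k} k≥1 k<n ascent _ , lab≡) | inj₁ ba =
    let b≡ , a≡ = ×-≡,≡←≡ (trans (sym lab≡) ba)
    in k , ascent⇒IsRise k≥1 k<n ascent , ×-≡,≡→≡ (a≡ , b≡)
  ... | inj₁ (_ , _ , nonneg {k} k≥1 k<n _ _ , lab≡) | inj₂ -a-b =
    ⊥-elim (entry≢-opposite a∈u (s≤s z≤n) k<n (proj₁ (×-≡,≡←≡ (trans (sym lab≡) -a-b))))
  ... | inj₁ (_ , _ , neg {k} k≥1 k<n _ _ , lab≡) | inj₁ ba =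
    ⊥-elim (member≢-opposite b∈u k≥1 (ℕP.<⇒≤ k<n) (sym (proj₁ (×-≡,≡←≡ (trans (sym lab≡) ba)))))
  ... | inj₁ (_ , _ , neg {k} k≥1 k<n ascent _ , lab≡) | inj₂ -a-b =
    let -a≡ , -b≡ = ×-≡,≡←≡ (trans (sym lab≡) -a-b)
    in k , ascent⇒IsRise k≥1 k<n ascent , ×-≡,≡→≡ (ℤP.neg-injective -a≡ , ℤP.neg-injective -b≡)
  ... | inj₂ (_ , lab≡) | inj₁ ba =
    ⊥-elim (member≢-opposite a∈u (s≤s z≤n) n≥1 (sym (proj₂ (×-≡,≡←≡ (trans (sym lab≡) ba)))))
  ... | inj₂ (_ , lab≡) | inj₂ -a-b =
    ⊥-elim (entry≢-opposite a∈u (s≤s z≤n) n≥1 (proj₁ (×-≡,≡←≡ (trans (sym lab≡) -a-b))))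

  first⇒valley : ∀ {a} → head π ≡ just N × uAt u 1 ≡ a → ∃ λ v → IsValley (zetaC n π) v × VL v ≡ (a , - a)
  first⇒valley (hN , refl) = head≡N⇒valley hN

  valley⇒first : ∀ {a} → a ∈ u → (∃ λ v → IsValley (zetaC n π) v × VL v ≡ (a , - a)) →
    head π ≡ just N × uAt u 1 ≡ a
  valley⇒first a∈u (v , isV , lab) with valley-cases isV
  ... | inj₁ (_ , _ , nonneg {k} k≥1 k<n _ _ , lab≡) =
    let a≡ , -a≡ = ×-≡,≡←≡ (trans (sym lab≡) lab)
    in ⊥-elim (no-opposite k≥1 (ℕP.<⇒≤ k<n) (s≤s z≤n) k<n (trans -a≡ (cong -_ (sym a≡))))
  ... | inj₁ (_ , _ , neg {k} k≥1 k<n _ _ , lab≡) =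
    ⊥-elim (member≢-opposite a∈u k≥1 (ℕP.<⇒≤ k<n) (sym (proj₁ (×-≡,≡←≡ (trans (sym lab≡) lab)))))
  ... | inj₂ (hN , lab≡) = hN , proj₁ (×-≡,≡←≡ (trans (sym lab≡) lab))

theorem4p20 : (n : ℕ) → 1 ≤ n → (π : Path) (u : List ℤ) → InVert n π u →
    (a b : ℤ) → a ∈ u → b ∈ u →
    ((∃ λ i → IsRise π i × riseLabel u i ≡ (a , b))
      ⇔ (∃ λ v → IsValley (zetaC n π) v
                 × (valleyLabel n (dC n π u) v ≡ (b , a) ⊎ valleyLabel n (dC n π u) v ≡ (- a , - b))))
    × ((head π ≡ just N × uAt u 1 ≡ a)
      ⇔ (∃ λ v → IsValley (zetaC n π) v × valleyLabel n (dC n π u) v ≡ (a , - a)))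
theorem4p20 n n≥1 π u vert a b a∈u b∈u =
  mk⇔ rise⇒valley (valley⇒rise a∈u b∈u) , mk⇔ first⇒valley (valley⇒first a∈u)
  where open Vertex n≥1 vert
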